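{- Let $t$ be an odd prime and let $n$ be an integer with $n\not\equiv 0\pmod t$. Then for all $0\leq i\leq t-1$, \[ M_t(i,t,n)=\frac{p_t(n)}{t},\qquad \overline{M}_t(i,t,n)=\frac{\overline{p}_t(n)}{t}\equiv 0\pmod 2,\qquad \hat{M}_t(i,t,n)=\frac{\hat{p}_t(n)}{t}. \] In particular, $p_t(n)\equiv \hat{p}_t(n)\equiv 0\pmod t$ and $\overline{p}_t(n)\equiv 0\pmod{2t}$.
   Context: An overpartition is a partition in which the first occurrence of each distinct part size may be overlined. A pod is a partition in which each odd part appears at most once. For a positive integer $t$, a $t$-colored partition (resp. overpartition, pod) of $n$ is a $t$-tuple $\vec\pi=(\pi_1,\dots,\pi_t)$ of partitions (resp. overpartitions, pods) with $\sum_k|\pi_k|=n$, where $|\pi|$ is the sum of parts. Let $p_t(n)$, $\overline{p}_t(n)$, $\hat{p}_t(n)$ denote the numbers of $t$-colored partitions, overpartitions, pods of $n$ respectively. Let $\ell(\pi)$ be the number of all parts of $\pi$ (overlined and non-overlined, odd and even, all counted). For odd $t$ define $r^*(\vec\pi)=\sum_{k=1}^{(t-1)/2}k\bigl(\ell(\pi_k)-\ell(\pi_{t-k})\bigr)$ (so $\pi_t$ does not contribute). Let $M_t(i,t,n)$ (resp. $\overline{M}_t(i,t,n)$, $\hat{M}_t(i,t,n)$) be the number of $t$-colored partitions (resp. overpartitions, pods) of $n$ with $r^*(\vec\pi)\equiv i\pmod t$. -}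

module Defs where

open import Data.Nat as ℕ using (ℕ; zero; suc; _+_; _*_; _∸_; _/_; _%_; _≤ᵇ_; _≡ᵇ_)
open import Data.Bool using (Bool; true; false; _∧_; _∨_; not)
open import Data.Product using (_×_; _,_)
open import Data.List as List using (List; []; _∷_; [_]; map; concatMap; filterᵇ; length; upTo; foldr)
open import Data.Vec as Vec using (Vec; []; _∷_; toList)
open import Data.Integer as ℤ using (ℤ; +_)
open import Data.Integer.Divisibility.Signed using (_∣?_)
open import Relation.Nullary using (does)

-- A single-coloured object of weight ≤ n is encoded by its data for
-- part sizes 1..n (parts larger than n cannot occur in an object of
-- weight n).  The j-th cell (j : 0..n-1) describes part size j+1 as a
-- pair (m , b): m = multiplicity of part size j+1 (number of parts of
-- that size, overlined or not), b = whether the first occurrence is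
-- overlined.
--   * partition   : b = false always;
--   * overpartition: b = true only if m ≥ 1;
--   * pod         : b = false, and m ≤ 1 if j+1 is odd.
-- A t-coloured object is a vector of t such encodings; the entry at
-- index k-1 is π_k.

Cell : Set
Cell = ℕ × Bool

-- validity of the cell for part size s
Kind : Set
Kind = ℕ → Cell → Bool

partitionCell : Kind
partitionCell s (m , b) = not b

overpartitionCell : Kind
overpartitionCell s (m , b) = not b ∨ (1 ≤ᵇ m)

podCell : Kind
podCell s (m , b) = not b ∧ ((s % 2 ≡ᵇ 0) ∨ (m ≤ᵇ 1))

-- all cells valid, first cell having part size (suc j)
validFrom : Kind → ℕ → ∀ {k} → Vec Cell k → Bool
validFrom K j [] = true
validFrom K j (c ∷ cs) = K (suc j) c ∧ validFrom K (suc j) cs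

sizeFrom : ℕ → ∀ {k} → Vec Cell k → ℕ
sizeFrom j [] = 0
sizeFrom j ((m , b) ∷ cs) = suc j * m + sizeFrom (suc j) cs

size : ∀ {k} → Vec Cell k → ℕ
size = sizeFrom 0

numParts : ∀ {k} → Vec Cell k → ℕ
numParts [] = 0
numParts ((m , b) ∷ cs) = m + numParts cs

allVecs : ∀ {A : Set} → List A → (k : ℕ) → List (Vec A k)
allVecs xs zero = [ [] ]
allVecs xs (suc k) = concatMap (λ x → map (x ∷_) (allVecs xs k)) xs

cells : ℕ → List Cell
cells n = concatMap (λ m → (m , false) ∷ (m , true) ∷ []) (upTo (suc n))

Colored : ℕ → ℕ → Set
Colored t n = Vec (Vec Cell n) t

candidates : (t n : ℕ) → List (Colored t n)
candidates t n = allVecs (allVecs (cells n) n) t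

allValid : Kind → ∀ {t n} → Colored t n → Bool
allValid K [] = true
allValid K (π ∷ πs) = validFrom K 0 π ∧ allValid K πs

totalSize : ∀ {t n} → Colored t n → ℕ
totalSize [] = 0
totalSize (π ∷ πs) = size π + totalSize πs

isColored : Kind → (t n : ℕ) → Colored t n → Bool
isColored K t n v = allValid K v ∧ (totalSize v ≡ᵇ n)

count : Kind → (t n : ℕ) → ℕ
count K t n = length (filterᵇ (isColored K t n) (candidates t n))

p : ℕ → ℕ → ℕ
p t n = count partitionCell t n

pbar : ℕ → ℕ → ℕ
pbar t n = count overpartitionCell t n

phat : ℕ → ℕ → ℕ
phat t n = count podCell t n

-- nth element of a list of naturals (0 outside the range)
nth : List ℕ → ℕ → ℕ
nth [] _ = 0
nth (x ∷ xs) zero = x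
nth (x ∷ xs) (suc i) = nth xs i

sumℤ : List ℤ → ℤ
sumℤ = foldr ℤ._+_ (+ 0)

-- r*(π) = Σ_{k=1}^{(t-1)/2} k (ℓ(π_k) - ℓ(π_{t-k})), with π_k at index k-1
rstar : ∀ {t n} → Colored t n → ℤ
rstar {t} v = sumℤ (map term (upTo ((t ∸ 1) / 2)))
  where
  ls : List ℕ
  ls = map numParts (toList v)
  -- term for k = suc i
  term : ℕ → ℤ
  term i = (+ suc i) ℤ.* ((+ nth ls i) ℤ.- (+ nth ls (t ∸ suc i ∸ 1)))

rstarMod : (i t : ℕ) → ∀ {n} → Colored t n → Bool
rstarMod i t v = does ((+ t) ∣? (rstar v ℤ.- (+ i)))

countM : Kind → (i t n : ℕ) → ℕ
countM K i t n = length (filterᵇ (λ v → isColored K t n v ∧ rstarMod i t v) (candidates t n))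

M : ℕ → ℕ → ℕ → ℕ
M i t n = countM partitionCell i t n

Mbar : ℕ → ℕ → ℕ → ℕ
Mbar i t n = countM overpartitionCell i t n

Mhat : ℕ → ℕ → ℕ → ℕ
Mhat i t n = countM podCell i t n

-- Write t = 2h + 1. Modulo t the colour t - k carries weight -k, so r*(π) ≡ Σ_k k ℓ(π_k) (mod t).
-- As n = Σ_s s c_s, where c_s counts the parts of size s in all colours, t ∤ n forces some c_s to be
-- prime to t. Cyclically shifting the parts of the first such size s by d colours, where d c_s ≡ 1
-- (mod t), preserves the kind and the weight of the object and lowers Σ_k k ℓ(π_k) by d c_s ≡ 1;
-- this bijection carries class i + 1 onto class i, so all t classes are equally large.
-- For overpartitions, toggling the overline of the smallest part of the first nonempty colour is a
-- fixed-point-free involution on each class, so every class has even size.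
module Submission where

open import Defs
open import Data.Nat using (ℕ; NonZero)

module Counting where
  open import Data.Nat using (ℕ; zero; suc; _+_; _*_; _<_; s≤s; z≤n; _≡ᵇ_)
  open import Data.Nat.Properties using (+-suc; *-zeroʳ)
  open import Data.Nat.Tactic.RingSolver using (solve-∀)
  open import Data.Bool using (Bool; true; false; _∧_; not; T?)
  open import Data.List using (List; []; _∷_; map; filterᵇ; length)
  open import Data.List.Properties using (length-map)
  open import Data.List.Membership.Propositional using (_∈_)
  open import Data.List.Membership.Propositional.Properties using (∈-map⁺; ∈-map⁻)
  open import Data.List.Membership.Propositional.Properties.WithK using (unique∧set⇒bag)
  open import Data.List.Relation.Unary.Unique.Propositional using (Unique)
  import Data.List.Relation.Unary.Unique.Propositional.Properties as Unique
  open import Data.List.Relation.Binary.BagAndSetEquality using (∼bag⇒↭)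
  open import Data.List.Relation.Binary.Permutation.Propositional using (_↭_)
  open import Data.List.Relation.Binary.Permutation.Propositional.Properties using (filter-↭; ↭-length)
  open import Data.Product using (_,_)
  open import Function using (_∘_)
  open import Function.Bundles using (mk⇔)
  open import Relation.Binary.PropositionalEquality
  open ≡-Reasoning

  filterᵇ-cong : ∀ {A : Set} {p q : A → Bool} → (∀ x → p x ≡ q x) → ∀ xs → filterᵇ p xs ≡ filterᵇ q xs
  filterᵇ-cong p≗q [] = refl
  filterᵇ-cong {q = q} p≗q (x ∷ xs) rewrite p≗q x with q x
  ... | true = cong (x ∷_) (filterᵇ-cong p≗q xs)
  ... | false = filterᵇ-cong p≗q xs

  map-filterᵇ : ∀ {A B : Set} (p : B → Bool) (f : A → B) xs →
    map f (filterᵇ (p ∘ f) xs) ≡ filterᵇ p (map f xs)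
  map-filterᵇ p f [] = refl
  map-filterᵇ p f (x ∷ xs) with p (f x)
  ... | true = cong (f x ∷_) (map-filterᵇ p f xs)
  ... | false = map-filterᵇ p f xs

  map-bijection-↭ : ∀ {A : Set} {f g : A → A} {xs : List A} → Unique xs →
    (∀ x → g (f x) ≡ x) → (∀ x → f (g x) ≡ x) →
    (∀ {x} → x ∈ xs → f x ∈ xs) → (∀ {x} → x ∈ xs → g x ∈ xs) → map f xs ↭ xs
  map-bijection-↭ {f = f} {g} {xs} uniq gf fg f-closed g-closed =
    ∼bag⇒↭ (unique∧set⇒bag (Unique.map⁺ f-injective uniq) uniq (mk⇔ to from))
    where
    f-injective : ∀ {x y} → f x ≡ f y → x ≡ y
    f-injective {x} {y} fx≡fy = trans (sym (gf x)) (trans (cong g fx≡fy) (gf y))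
    to : ∀ {y} → y ∈ map f xs → y ∈ xs
    to y∈ with ∈-map⁻ f y∈
    ... | x , x∈ , refl = f-closed x∈
    from : ∀ {y} → y ∈ xs → y ∈ map f xs
    from {y} y∈ = subst (_∈ map f xs) (fg y) (∈-map⁺ f (g-closed y∈))

  length-filterᵇ-bijection : ∀ {A : Set} (p : A → Bool) {f g : A → A} {xs : List A} → Unique xs →
    (∀ x → g (f x) ≡ x) → (∀ x → f (g x) ≡ x) →
    (∀ {x} → x ∈ xs → f x ∈ xs) → (∀ {x} → x ∈ xs → g x ∈ xs) →
    length (filterᵇ (p ∘ f) xs) ≡ length (filterᵇ p xs)
  length-filterᵇ-bijection p {f} {xs = xs} uniq gf fg f-closed g-closed = begin
    length (filterᵇ (p ∘ f) xs)       ≡⟨ sym (length-map f (filterᵇ (p ∘ f) xs)) ⟩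
    length (map f (filterᵇ (p ∘ f) xs)) ≡⟨ cong length (map-filterᵇ p f xs) ⟩
    length (filterᵇ p (map f xs))     ≡⟨ ↭-length (filter-↭ (T? ∘ p) (map-bijection-↭ uniq gf fg f-closed g-closed)) ⟩
    length (filterᵇ p xs)             ∎

  length-filterᵇ-split : ∀ {A : Set} (p q : A → Bool) xs → length (filterᵇ p xs) ≡
    length (filterᵇ (λ x → p x ∧ q x) xs) + length (filterᵇ (λ x → p x ∧ not (q x)) xs)
  length-filterᵇ-split p q [] = refl
  length-filterᵇ-split p q (x ∷ xs) with p x | q x
  ... | true  | true  = cong suc (length-filterᵇ-split p q xs)
  ... | true  | false = trans (cong suc (length-filterᵇ-split p q xs)) (sym (+-suc _ _))
  ... | false | _     = length-filterᵇ-split p q xs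

  sumBelow : (ℕ → ℕ) → ℕ → ℕ
  sumBelow f zero = 0
  sumBelow f (suc k) = f 0 + sumBelow (f ∘ suc) k

  sumBelow-cong : ∀ {f g : ℕ → ℕ} k → (∀ i → i < k → f i ≡ g i) → sumBelow f k ≡ sumBelow g k
  sumBelow-cong zero f≗g = refl
  sumBelow-cong (suc k) f≗g = cong₂ _+_ (f≗g 0 (s≤s z≤n)) (sumBelow-cong k (λ i i<k → f≗g (suc i) (s≤s i<k)))

  sumBelow-+ : ∀ (f g : ℕ → ℕ) k → sumBelow (λ i → f i + g i) k ≡ sumBelow f k + sumBelow g k
  sumBelow-+ f g zero = refl
  sumBelow-+ f g (suc k) = trans (cong (f 0 + g 0 +_) (sumBelow-+ (f ∘ suc) (g ∘ suc) k)) (swap (f 0) (g 0) _ _)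
    where
    swap : ∀ a b c d → a + b + (c + d) ≡ a + c + (b + d)
    swap = solve-∀

  sumBelow-const : ∀ c k → sumBelow (λ _ → c) k ≡ k * c
  sumBelow-const c zero = refl
  sumBelow-const c (suc k) = cong (c +_) (sumBelow-const c k)

  sumBelow-zero : ∀ k → sumBelow (λ _ → 0) k ≡ 0
  sumBelow-zero k = trans (sumBelow-const 0 k) (*-zeroʳ k)

  indicator : Bool → ℕ
  indicator true = 1
  indicator false = 0

  length-filterᵇ-∷ : ∀ {A : Set} (p : A → Bool) x xs →
    length (filterᵇ p (x ∷ xs)) ≡ indicator (p x) + length (filterᵇ p xs)
  length-filterᵇ-∷ p x xs with p x
  ... | true = refl
  ... | false = refl

  length-filterᵇ-classes : ∀ {A : Set} (p : A → Bool) (class : ℕ → A → Bool) k →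
    (∀ x → sumBelow (λ i → indicator (class i x)) k ≡ 1) → ∀ xs →
    sumBelow (λ i → length (filterᵇ (λ x → p x ∧ class i x) xs)) k ≡ length (filterᵇ p xs)
  length-filterᵇ-classes p class k unique-class [] = sumBelow-zero k
  length-filterᵇ-classes {A} p class k unique-class (x ∷ xs) = begin
    sumBelow (λ i → length (filterᵇ (p∧ i) (x ∷ xs))) k
      ≡⟨ sumBelow-cong k (λ i _ → length-filterᵇ-∷ (p∧ i) x xs) ⟩
    sumBelow (λ i → indicator (p∧ i x) + length (filterᵇ (p∧ i) xs)) k
      ≡⟨ sumBelow-+ _ _ k ⟩
    sumBelow (λ i → indicator (p∧ i x)) k + sumBelow (λ i → length (filterᵇ (p∧ i) xs)) k
      ≡⟨ cong₂ _+_ (contribution (p x)) (length-filterᵇ-classes p class k unique-class xs) ⟩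
    indicator (p x) + length (filterᵇ p xs)
      ≡⟨ sym (length-filterᵇ-∷ p x xs) ⟩
    length (filterᵇ p (x ∷ xs)) ∎
    where
    p∧ : ℕ → A → Bool
    p∧ i y = p y ∧ class i y
    contribution : ∀ b → sumBelow (λ i → indicator (b ∧ class i x)) k ≡ indicator b
    contribution true = unique-class x
    contribution false = sumBelow-zero k

  sumBelow-indicator-≡ᵇ : ∀ {k} t → k < t → sumBelow (λ i → indicator (i ≡ᵇ k)) t ≡ 1
  sumBelow-indicator-≡ᵇ {zero} (suc t) _ = cong suc (sumBelow-zero t)
  sumBelow-indicator-≡ᵇ {suc k} (suc t) (s≤s k<t) = sumBelow-indicator-≡ᵇ t k<t

module Enumeration where
  open import Data.Nat using (ℕ; zero; suc)
  open import Data.Bool using (true; false)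
  open import Data.List using (List; []; _∷_; map; concatMap; upTo)
  open import Data.Vec using (Vec; []; _∷_)
  open import Data.Vec.Relation.Unary.All as All using (All; []; _∷_)
  import Data.List.Relation.Unary.All as ListAll
  open import Data.List.Relation.Unary.Any as Any using (here; there)
  import Data.List.Relation.Unary.AllPairs as AllPairs
  open import Data.List.Membership.Propositional using (_∈_; find)
  open import Data.List.Membership.Propositional.Properties using (∈-map⁺; ∈-map⁻; ∈-concatMap⁺; ∈-concatMap⁻)
  open import Data.List.Relation.Unary.Unique.Propositional using (Unique)
  import Data.List.Relation.Unary.Unique.Propositional.Properties as Unique
  open import Data.Vec.Properties using (∷-injectiveʳ)
  open import Data.Product using (_,_; _×_; proj₁; ∃)
  open import Data.Empty using (⊥)
  open import Relation.Binary.PropositionalEquality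

  ∈-concatMap⁺′ : ∀ {A B : Set} (f : A → List B) {x y xs} → x ∈ xs → y ∈ f x → y ∈ concatMap f xs
  ∈-concatMap⁺′ f x∈ y∈ = ∈-concatMap⁺ f (Any.map (λ { refl → y∈ }) x∈)

  ∈-concatMap⁻′ : ∀ {A B : Set} (f : A → List B) {y} xs → y ∈ concatMap f xs → ∃ λ x → x ∈ xs × y ∈ f x
  ∈-concatMap⁻′ f xs y∈ = find (∈-concatMap⁻ f y∈)

  concatMap-unique : ∀ {A B : Set} (f : A → List B) (key : B → A) →
    (∀ x → Unique (f x)) → (∀ {x y} → y ∈ f x → key y ≡ x) →
    ∀ {xs} → Unique xs → Unique (concatMap f xs)
  concatMap-unique f key f-unique key-f {[]} _ = AllPairs.[]
  concatMap-unique f key f-unique key-f {x ∷ xs} (x∉xs AllPairs.∷ uniq) =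
    Unique.++⁺ (f-unique x) (concatMap-unique f key f-unique key-f uniq) disjoint
    where
    disjoint : ∀ {y} → y ∈ f x × y ∈ concatMap f xs → ⊥
    disjoint (y∈fx , y∈rest) with ∈-concatMap⁻′ f xs y∈rest
    ... | z , z∈xs , y∈fz with key-f y∈fx | key-f y∈fz
    ... | refl | refl = ListAll.lookup x∉xs z∈xs refl

  allVecs-complete : ∀ {A : Set} (xs : List A) {k} (v : Vec A k) → All (_∈ xs) v → v ∈ allVecs xs k
  allVecs-complete xs [] [] = here refl
  allVecs-complete xs (x ∷ v) (x∈ ∷ v∈) = ∈-concatMap⁺′ _ x∈ (∈-map⁺ (x ∷_) (allVecs-complete xs v v∈))

  allVecs-sound : ∀ {A : Set} (xs : List A) {k} (v : Vec A k) → v ∈ allVecs xs k → All (_∈ xs) v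
  allVecs-sound xs [] _ = []
  allVecs-sound xs (x ∷ v) x∷v∈ with ∈-concatMap⁻′ _ xs x∷v∈
  ... | _ , x∈ , x∷v∈′ with ∈-map⁻ _ x∷v∈′
  ... | _ , v∈ , refl = x∈ ∷ allVecs-sound xs v v∈

  allVecs-unique : ∀ {A : Set} (xs : List A) k → Unique xs → Unique (allVecs xs k)
  allVecs-unique xs zero _ = ListAll.[] AllPairs.∷ AllPairs.[]
  allVecs-unique [] (suc k) _ = AllPairs.[]
  allVecs-unique (d ∷ ds) (suc k) uniq =
    concatMap-unique _ (head d) (λ x → Unique.map⁺ (∷-injectiveʳ {x = x}) (allVecs-unique (d ∷ ds) k uniq)) head-∷ uniq
    where
    head : ∀ {A : Set} {k} → A → Vec A k → A
    head default [] = default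
    head _ (x ∷ _) = x
    head-∷ : ∀ {x y} → y ∈ map (x ∷_) (allVecs (d ∷ ds) k) → head d y ≡ x
    head-∷ y∈ with ∈-map⁻ _ y∈
    ... | _ , _ , refl = refl

  cellsOf : ℕ → List Cell
  cellsOf m = (m , false) ∷ (m , true) ∷ []

  cells-unique : ∀ n → Unique (cells n)
  cells-unique n = concatMap-unique cellsOf proj₁ cellsOf-unique proj₁-cellsOf (Unique.upTo⁺ (suc n))
    where
    cellsOf-unique : ∀ m → Unique (cellsOf m)
    cellsOf-unique m = ((λ ()) ListAll.∷ ListAll.[]) AllPairs.∷ (ListAll.[] AllPairs.∷ AllPairs.[])
    proj₁-cellsOf : ∀ {m c} → c ∈ cellsOf m → proj₁ c ≡ m
    proj₁-cellsOf (here refl) = refl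
    proj₁-cellsOf (there (here refl)) = refl

  ∈-cellsOf : ∀ m b → (m , b) ∈ cellsOf m
  ∈-cellsOf m false = here refl
  ∈-cellsOf m true = there (here refl)

  cells-overline : ∀ {n m b} b′ → (m , b) ∈ cells n → (m , b′) ∈ cells n
  cells-overline {n} b′ c∈ with ∈-concatMap⁻′ cellsOf (upTo (suc n)) c∈
  ... | m , m∈ , here refl = ∈-concatMap⁺′ cellsOf m∈ (∈-cellsOf m b′)
  ... | m , m∈ , there (here refl) = ∈-concatMap⁺′ cellsOf m∈ (∈-cellsOf m b′)

  candidates-unique : ∀ t n → Unique (candidates t n)
  candidates-unique t n = allVecs-unique _ t (allVecs-unique _ n (cells-unique n))

  ∈-candidates⁺ : ∀ {t n} (v : Colored t n) → All (All (_∈ cells n)) v → v ∈ candidates t n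
  ∈-candidates⁺ {n = n} v v∈ = allVecs-complete _ v (All.map (λ {π} → allVecs-complete (cells n) π) v∈)

  ∈-candidates⁻ : ∀ {t n} (v : Colored t n) → v ∈ candidates t n → All (All (_∈ cells n)) v
  ∈-candidates⁻ {n = n} v v∈ = All.map (λ {π} → allVecs-sound (cells n) π) (allVecs-sound _ v v∈)

module Rotation where
  open import Data.Nat using (ℕ; zero; suc; _+_; _*_)
  open import Data.Nat.Properties using (+-identityʳ)
  open import Data.Nat.Tactic.RingSolver using (solve-∀)
  open import Data.List as List using (List; []; _∷_; _++_)
  import Data.List.Properties as List
  open import Data.Vec using (Vec; []; _∷_; _∷ʳ_; toList)
  open import Data.Vec.Properties using (toList-∷ʳ; toList-injective; cast-is-id; length-toList)
  open import Data.Vec.Relation.Unary.All using (All; []; _∷_)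
  open import Data.Product using (_,_; proj₁; ∃)
  open import Relation.Binary.PropositionalEquality
  open ≡-Reasoning

  rotate : ∀ {A : Set} {k} → Vec A k → Vec A k
  rotate [] = []
  rotate (x ∷ xs) = xs ∷ʳ x

  rotateBy : ∀ {A : Set} {k} → ℕ → Vec A k → Vec A k
  rotateBy zero v = v
  rotateBy (suc d) v = rotate (rotateBy d v)

  rotateBy-+ : ∀ {A : Set} {k} d e (v : Vec A k) → rotateBy (d + e) v ≡ rotateBy d (rotateBy e v)
  rotateBy-+ zero e v = refl
  rotateBy-+ (suc d) e v = cong rotate (rotateBy-+ d e v)

  rotateListBy : ∀ {A : Set} → ℕ → List A → List A
  rotateListBy zero xs = xs
  rotateListBy (suc d) xs = rotateListBy d (List.drop 1 xs ++ List.take 1 xs)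

  rotateListBy-++ : ∀ {A : Set} (xs ys : List A) → rotateListBy (List.length xs) (xs ++ ys) ≡ ys ++ xs
  rotateListBy-++ [] ys = sym (List.++-identityʳ ys)
  rotateListBy-++ (x ∷ xs) ys = begin
    rotateListBy (List.length xs) ((xs ++ ys) ++ x ∷ [])  ≡⟨ cong (rotateListBy (List.length xs)) (List.++-assoc xs ys _) ⟩
    rotateListBy (List.length xs) (xs ++ (ys ++ x ∷ []))  ≡⟨ rotateListBy-++ xs _ ⟩
    (ys ++ x ∷ []) ++ xs                                   ≡⟨ List.++-assoc ys _ xs ⟩
    ys ++ x ∷ xs                                           ∎

  rotateListBy-suc : ∀ {A : Set} d (xs : List A) →
    rotateListBy (suc d) xs ≡ List.drop 1 (rotateListBy d xs) ++ List.take 1 (rotateListBy d xs)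
  rotateListBy-suc zero xs = refl
  rotateListBy-suc (suc d) xs = rotateListBy-suc d _

  toList-rotateBy : ∀ {A : Set} {k} d (v : Vec A k) → toList (rotateBy d v) ≡ rotateListBy d (toList v)
  toList-rotateBy zero v = refl
  toList-rotateBy (suc d) v = trans (toList-rotate (rotateBy d v))
    (trans (cong (λ xs → List.drop 1 xs ++ List.take 1 xs) (toList-rotateBy d v)) (sym (rotateListBy-suc d _)))
    where
    toList-rotate : ∀ {k} (w : Vec _ k) → toList (rotate w) ≡ List.drop 1 (toList w) ++ List.take 1 (toList w)
    toList-rotate [] = refl
    toList-rotate (x ∷ xs) = toList-∷ʳ x xs

  rotateBy-length : ∀ {A : Set} {k} (v : Vec A k) → rotateBy k v ≡ v
  rotateBy-length {k = k} v = trans (sym (cast-is-id refl (rotateBy k v))) (toList-injective refl _ _ (begin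
    toList (rotateBy k v)                               ≡⟨ toList-rotateBy k v ⟩
    rotateListBy k (toList v)                           ≡⟨ cong (λ d → rotateListBy d (toList v)) (sym (length-toList v)) ⟩
    rotateListBy (List.length (toList v)) (toList v)    ≡⟨ cong (rotateListBy (List.length (toList v))) (sym (List.++-identityʳ (toList v))) ⟩
    rotateListBy (List.length (toList v)) (toList v ++ []) ≡⟨ rotateListBy-++ (toList v) [] ⟩
    toList v                                            ∎))

  All-∷ʳ : ∀ {A : Set} {P : A → Set} {k} {xs : Vec A k} {x} → All P xs → P x → All P (xs ∷ʳ x)
  All-∷ʳ [] px = px ∷ []
  All-∷ʳ (py ∷ pxs) px = py ∷ All-∷ʳ pxs px

  All-rotateBy : ∀ {A : Set} {P : A → Set} {k} d {v : Vec A k} → All P v → All P (rotateBy d v)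
  All-rotateBy zero pv = pv
  All-rotateBy (suc d) pv = All-rotate (All-rotateBy d pv)
    where
    All-rotate : ∀ {A : Set} {P : A → Set} {k} {w : Vec A k} → All P w → All P (rotate w)
    All-rotate [] = []
    All-rotate (px ∷ pxs) = All-∷ʳ pxs px

  multiplicity : ∀ {k} → Vec Cell k → ℕ
  multiplicity [] = 0
  multiplicity (c ∷ cs) = proj₁ c + multiplicity cs

  colourWeight : ℕ → ∀ {k} → Vec Cell k → ℕ
  colourWeight a [] = 0
  colourWeight a (c ∷ cs) = a * proj₁ c + colourWeight (suc a) cs

  multiplicity-rotate : ∀ {k} (v : Vec Cell k) → multiplicity (rotate v) ≡ multiplicity v
  multiplicity-rotate [] = refl
  multiplicity-rotate (c ∷ cs) = multiplicity-∷ʳ cs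
    where
    multiplicity-∷ʳ : ∀ {k} (xs : Vec Cell k) → multiplicity (xs ∷ʳ c) ≡ proj₁ c + multiplicity xs
    multiplicity-∷ʳ [] = refl
    multiplicity-∷ʳ (y ∷ xs) = trans (cong (proj₁ y +_) (multiplicity-∷ʳ xs)) (swap (proj₁ y) (proj₁ c) _)
      where
      swap : ∀ a b c → a + (b + c) ≡ b + (a + c)
      swap = solve-∀

  multiplicity-rotateBy : ∀ {k} d (v : Vec Cell k) → multiplicity (rotateBy d v) ≡ multiplicity v
  multiplicity-rotateBy zero v = refl
  multiplicity-rotateBy (suc d) v = trans (multiplicity-rotate (rotateBy d v)) (multiplicity-rotateBy d v)

  colourWeight-∷ʳ : ∀ a {k} (xs : Vec Cell k) c → colourWeight a (xs ∷ʳ c) ≡ colourWeight a xs + (a + k) * proj₁ c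
  colourWeight-∷ʳ a [] c = trans (+-identityʳ _) (cong (_* proj₁ c) (sym (+-identityʳ a)))
  colourWeight-∷ʳ a {suc k} (y ∷ xs) c = begin
    a * proj₁ y + colourWeight (suc a) (xs ∷ʳ c)           ≡⟨ cong (a * proj₁ y +_) (colourWeight-∷ʳ (suc a) xs c) ⟩
    a * proj₁ y + (colourWeight (suc a) xs + (suc a + k) * proj₁ c) ≡⟨ shift (a * proj₁ y) (colourWeight (suc a) xs) a k (proj₁ c) ⟩
    a * proj₁ y + colourWeight (suc a) xs + (a + suc k) * proj₁ c ∎
    where
    shift : ∀ u w a k m → u + (w + (suc a + k) * m) ≡ u + w + (a + suc k) * m
    shift = solve-∀

  colourWeight-suc : ∀ a {k} (xs : Vec Cell k) → colourWeight (suc a) xs ≡ colourWeight a xs + multiplicity xs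
  colourWeight-suc a [] = refl
  colourWeight-suc a (y ∷ xs) = begin
    suc a * proj₁ y + colourWeight (suc (suc a)) xs              ≡⟨ cong (suc a * proj₁ y +_) (colourWeight-suc (suc a) xs) ⟩
    suc a * proj₁ y + (colourWeight (suc a) xs + multiplicity xs) ≡⟨ regroup a (proj₁ y) (colourWeight (suc a) xs) (multiplicity xs) ⟩
    a * proj₁ y + colourWeight (suc a) xs + (proj₁ y + multiplicity xs) ∎
    where
    regroup : ∀ a m w s → suc a * m + (w + s) ≡ a * m + w + (m + s)
    regroup = solve-∀

  colourWeight-rotate : ∀ {k} (w : Vec Cell k) →
    ∃ λ Y → colourWeight 1 (rotate w) + multiplicity w ≡ colourWeight 1 w + k * Y
  colourWeight-rotate [] = 0 , refl
  colourWeight-rotate {suc k} (c ∷ cs) = proj₁ c , (begin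
    colourWeight 1 (cs ∷ʳ c) + (proj₁ c + multiplicity cs)               ≡⟨ cong (_+ (proj₁ c + multiplicity cs)) (colourWeight-∷ʳ 1 cs c) ⟩
    colourWeight 1 cs + suc k * proj₁ c + (proj₁ c + multiplicity cs)    ≡⟨ regroup (colourWeight 1 cs) (suc k * proj₁ c) (proj₁ c) (multiplicity cs) ⟩
    1 * proj₁ c + (colourWeight 1 cs + multiplicity cs) + suc k * proj₁ c ≡⟨ cong (λ w → 1 * proj₁ c + w + suc k * proj₁ c) (sym (colourWeight-suc 1 cs)) ⟩
    1 * proj₁ c + colourWeight 2 cs + suc k * proj₁ c                    ∎)
    where
    regroup : ∀ w u m s → w + u + (m + s) ≡ 1 * m + (w + s) + u
    regroup = solve-∀

  colourWeight-rotateBy : ∀ {k} d (v : Vec Cell k) →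
    ∃ λ X → colourWeight 1 (rotateBy d v) + d * multiplicity v ≡ colourWeight 1 v + k * X
  colourWeight-rotateBy {k} zero v = 0 , regroup (colourWeight 1 v) k
    where
    regroup : ∀ w k → w + 0 ≡ w + k * 0
    regroup = solve-∀
  colourWeight-rotateBy {k} (suc d) v
    with colourWeight-rotate (rotateBy d v) | colourWeight-rotateBy d v
  ... | Y , rotate-step | X , rotateBy-step = X + Y , (begin
    colourWeight 1 (rotate w) + (multiplicity v + d * multiplicity v)
      ≡⟨ cong (λ m → colourWeight 1 (rotate w) + (m + d * multiplicity v)) (sym (multiplicity-rotateBy d v)) ⟩
    colourWeight 1 (rotate w) + (multiplicity w + d * multiplicity v) ≡⟨ regroup₁ (colourWeight 1 (rotate w)) _ _ ⟩
    (colourWeight 1 (rotate w) + multiplicity w) + d * multiplicity v ≡⟨ cong (_+ d * multiplicity v) rotate-step ⟩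
    colourWeight 1 w + k * Y + d * multiplicity v                     ≡⟨ regroup₂ (colourWeight 1 w) (k * Y) _ ⟩
    (colourWeight 1 w + d * multiplicity v) + k * Y                   ≡⟨ cong (_+ k * Y) rotateBy-step ⟩
    colourWeight 1 v + k * X + k * Y                                  ≡⟨ regroup₃ (colourWeight 1 v) k X Y ⟩
    colourWeight 1 v + k * (X + Y)                                    ∎)
    where
    w = rotateBy d v
    regroup₁ : ∀ a b c → a + (b + c) ≡ a + b + c
    regroup₁ = solve-∀
    regroup₂ : ∀ a b c → a + b + c ≡ a + c + b
    regroup₂ = solve-∀
    regroup₃ : ∀ a k x y → a + k * x + k * y ≡ a + k * (x + y)
    regroup₃ = solve-∀

module Columns where
  open import Data.Nat using (ℕ; zero; suc; _+_; _*_)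
  open import Data.Nat.Properties using (+-identityʳ; +-suc; +-assoc)
  open import Data.Nat.Tactic.RingSolver using (solve-∀)
  open import Data.Bool using (true; _∧_)
  open import Data.Bool.Properties using (∧-conicalˡ; ∧-conicalʳ)
  open import Data.Fin using (Fin; zero; suc; toℕ)
  open import Data.Vec using (Vec; []; _∷_; lookup; _[_]≔_)
  open import Data.Vec.Properties using (lookup∘update; lookup∘update′; []≔-idempotent; []≔-lookup)
  open import Data.Vec.Relation.Unary.All using (All; []; _∷_)
  open import Data.Vec.Relation.Unary.All.Properties using (lookup⁺)
  open import Data.Product using (_,_; proj₁)
  open import Relation.Binary.PropositionalEquality
  open import Relation.Nullary using (¬_)
  open ≡-Reasoning
  open Rotation using (multiplicity; colourWeight)

  -- The s-th column of a coloured object lists, colour by colour, the cell of part size s + 1.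
  getColumn : ∀ {t n} → Fin n → Colored t n → Vec Cell t
  getColumn s [] = []
  getColumn s (π ∷ v) = lookup π s ∷ getColumn s v

  setColumn : ∀ {t n} → Fin n → Vec Cell t → Colored t n → Colored t n
  setColumn s [] [] = []
  setColumn s (c ∷ col) (π ∷ v) = (π [ s ]≔ c) ∷ setColumn s col v

  getColumn-setColumn : ∀ {t n} s (col : Vec Cell t) (v : Colored t n) → getColumn s (setColumn s col v) ≡ col
  getColumn-setColumn s [] [] = refl
  getColumn-setColumn s (c ∷ col) (π ∷ v) = cong₂ _∷_ (lookup∘update s π c) (getColumn-setColumn s col v)

  getColumn-setColumn′ : ∀ {t n} {s j} (col : Vec Cell t) (v : Colored t n) → ¬ j ≡ s →
    getColumn j (setColumn s col v) ≡ getColumn j v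
  getColumn-setColumn′ [] [] j≢s = refl
  getColumn-setColumn′ (c ∷ col) (π ∷ v) j≢s = cong₂ _∷_ (lookup∘update′ j≢s π c) (getColumn-setColumn′ col v j≢s)

  setColumn-getColumn : ∀ {t n} s (v : Colored t n) → setColumn s (getColumn s v) v ≡ v
  setColumn-getColumn s [] = refl
  setColumn-getColumn s (π ∷ v) = cong₂ _∷_ ([]≔-lookup π s) (setColumn-getColumn s v)

  setColumn-setColumn : ∀ {t n} s (col col′ : Vec Cell t) (v : Colored t n) →
    setColumn s col (setColumn s col′ v) ≡ setColumn s col v
  setColumn-setColumn s [] [] [] = refl
  setColumn-setColumn s (c ∷ col) (c′ ∷ col′) (π ∷ v) = cong₂ _∷_ ([]≔-idempotent π s) (setColumn-setColumn s col col′ v)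

  partWeight : ℕ → ∀ {t n} → Colored t n → ℕ
  partWeight a [] = 0
  partWeight a (π ∷ v) = a * numParts π + partWeight (suc a) v

  numParts-≔ : ∀ {k} (π : Vec Cell k) s c → numParts (π [ s ]≔ c) + proj₁ (lookup π s) ≡ numParts π + proj₁ c
  numParts-≔ ((m , _) ∷ π) zero (m′ , _) = swap m m′ (numParts π)
    where
    swap : ∀ a b c → b + c + a ≡ a + c + b
    swap = solve-∀
  numParts-≔ ((m , _) ∷ π) (suc s) c = begin
    m + numParts (π [ s ]≔ c) + proj₁ (lookup π s)   ≡⟨ +-assoc m _ _ ⟩
    m + (numParts (π [ s ]≔ c) + proj₁ (lookup π s)) ≡⟨ cong (m +_) (numParts-≔ π s c) ⟩
    m + (numParts π + proj₁ c)                       ≡⟨ +-assoc m _ _ ⟨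
    m + numParts π + proj₁ c                         ∎

  sizeFrom-≔ : ∀ {k} j (π : Vec Cell k) s c →
    sizeFrom j (π [ s ]≔ c) + suc (j + toℕ s) * proj₁ (lookup π s) ≡ sizeFrom j π + suc (j + toℕ s) * proj₁ c
  sizeFrom-≔ j ((m , _) ∷ π) zero (m′ , _) rewrite +-identityʳ j = swap (suc j) m m′ (sizeFrom (suc j) π)
    where
    swap : ∀ a m m′ z → a * m′ + z + a * m ≡ a * m + z + a * m′
    swap = solve-∀
  sizeFrom-≔ j ((m , _) ∷ π) (suc s) c rewrite +-suc j (toℕ s) = begin
    suc j * m + sizeFrom (suc j) (π [ s ]≔ c) + w * proj₁ (lookup π s)   ≡⟨ +-assoc (suc j * m) _ _ ⟩
    suc j * m + (sizeFrom (suc j) (π [ s ]≔ c) + w * proj₁ (lookup π s)) ≡⟨ cong (suc j * m +_) (sizeFrom-≔ (suc j) π s c) ⟩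
    suc j * m + (sizeFrom (suc j) π + w * proj₁ c)                       ≡⟨ +-assoc (suc j * m) _ _ ⟨
    suc j * m + sizeFrom (suc j) π + w * proj₁ c                         ∎
    where
    w = suc (suc j + toℕ s)

  partWeight-setColumn : ∀ a {t n} s (col : Vec Cell t) (v : Colored t n) →
    partWeight a (setColumn s col v) + colourWeight a (getColumn s v) ≡ partWeight a v + colourWeight a col
  partWeight-setColumn a s [] [] = refl
  partWeight-setColumn a s (c ∷ col) (π ∷ v) = begin
    a * numParts (π [ s ]≔ c) + partWeight (suc a) (setColumn s col v) + (a * proj₁ (lookup π s) + colourWeight (suc a) (getColumn s v))
      ≡⟨ regroup a (numParts (π [ s ]≔ c)) (proj₁ (lookup π s)) _ _ ⟩
    a * (numParts (π [ s ]≔ c) + proj₁ (lookup π s)) + (partWeight (suc a) (setColumn s col v) + colourWeight (suc a) (getColumn s v))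
      ≡⟨ cong₂ (λ x y → a * x + y) (numParts-≔ π s c) (partWeight-setColumn (suc a) s col v) ⟩
    a * (numParts π + proj₁ c) + (partWeight (suc a) v + colourWeight (suc a) col)
      ≡⟨ sym (regroup a (numParts π) (proj₁ c) _ _) ⟩
    a * numParts π + partWeight (suc a) v + (a * proj₁ c + colourWeight (suc a) col) ∎
    where
    regroup : ∀ a p q l w → a * p + l + (a * q + w) ≡ a * (p + q) + (l + w)
    regroup = solve-∀

  totalSize-setColumn : ∀ {t n} s (col : Vec Cell t) (v : Colored t n) →
    totalSize (setColumn s col v) + suc (toℕ s) * multiplicity (getColumn s v) ≡ totalSize v + suc (toℕ s) * multiplicity col
  totalSize-setColumn s [] [] = refl
  totalSize-setColumn s (c ∷ col) (π ∷ v) = begin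
    size (π [ s ]≔ c) + totalSize (setColumn s col v) + w * (proj₁ (lookup π s) + multiplicity (getColumn s v))
      ≡⟨ regroup w (size (π [ s ]≔ c)) (proj₁ (lookup π s)) _ _ ⟩
    (size (π [ s ]≔ c) + w * proj₁ (lookup π s)) + (totalSize (setColumn s col v) + w * multiplicity (getColumn s v))
      ≡⟨ cong₂ _+_ (sizeFrom-≔ 0 π s c) (totalSize-setColumn s col v) ⟩
    (size π + w * proj₁ c) + (totalSize v + w * multiplicity col)
      ≡⟨ sym (regroup w (size π) (proj₁ c) _ _) ⟩
    size π + totalSize v + w * (proj₁ c + multiplicity col) ∎
    where
    w = suc (toℕ s)
    regroup : ∀ a p q l m → p + l + a * (q + m) ≡ (p + a * q) + (l + a * m)
    regroup = solve-∀

  validFrom-lookup : ∀ (K : Kind) {k} j (π : Vec Cell k) s → validFrom K j π ≡ true → K (suc (j + toℕ s)) (lookup π s) ≡ true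
  validFrom-lookup K j (c ∷ π) zero valid rewrite +-identityʳ j = ∧-conicalˡ _ _ valid
  validFrom-lookup K j (c ∷ π) (suc s) valid rewrite +-suc j (toℕ s) = validFrom-lookup K (suc j) π s (∧-conicalʳ _ _ valid)

  validFrom-≔ : ∀ (K : Kind) {k} j (π : Vec Cell k) s c → validFrom K j π ≡ true → K (suc (j + toℕ s)) c ≡ true →
    validFrom K j (π [ s ]≔ c) ≡ true
  validFrom-≔ K j (_ ∷ π) zero c valid valid-c rewrite +-identityʳ j = cong₂ _∧_ valid-c (∧-conicalʳ _ _ valid)
  validFrom-≔ K j (_ ∷ π) (suc s) c valid valid-c rewrite +-suc j (toℕ s) =
    cong₂ _∧_ (∧-conicalˡ _ _ valid) (validFrom-≔ K (suc j) π s c (∧-conicalʳ _ _ valid) valid-c)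

  allValid-getColumn : ∀ (K : Kind) {t n} s (v : Colored t n) → allValid K v ≡ true →
    All (λ c → K (suc (toℕ s)) c ≡ true) (getColumn s v)
  allValid-getColumn K s [] valid = []
  allValid-getColumn K s (π ∷ v) valid =
    validFrom-lookup K 0 π s (∧-conicalˡ _ _ valid) ∷ allValid-getColumn K s v (∧-conicalʳ _ _ valid)

  allValid-setColumn : ∀ (K : Kind) {t n} s (col : Vec Cell t) (v : Colored t n) → allValid K v ≡ true →
    All (λ c → K (suc (toℕ s)) c ≡ true) col → allValid K (setColumn s col v) ≡ true
  allValid-setColumn K s [] [] valid [] = refl
  allValid-setColumn K s (c ∷ col) (π ∷ v) valid (valid-c ∷ valid-col) =
    cong₂ _∧_ (validFrom-≔ K 0 π s c (∧-conicalˡ _ _ valid) valid-c) (allValid-setColumn K s col v (∧-conicalʳ _ _ valid) valid-col)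

  All-≔ : ∀ {A : Set} {P : A → Set} {k} (xs : Vec A k) s {x} → All P xs → P x → All P (xs [ s ]≔ x)
  All-≔ (_ ∷ xs) zero (_ ∷ pxs) px = px ∷ pxs
  All-≔ (_ ∷ xs) (suc s) (py ∷ pxs) px = py ∷ All-≔ xs s pxs px

  All-getColumn : ∀ {P : Cell → Set} {t n} s (v : Colored t n) → All (All P) v → All P (getColumn s v)
  All-getColumn s [] [] = []
  All-getColumn s (π ∷ v) (pπ ∷ pv) = lookup⁺ pπ s ∷ All-getColumn s v pv

  All-setColumn : ∀ {P : Cell → Set} {t n} s (col : Vec Cell t) (v : Colored t n) →
    All (All P) v → All P col → All (All P) (setColumn s col v)
  All-setColumn s [] [] [] [] = []
  All-setColumn s (c ∷ col) (π ∷ v) (pπ ∷ pv) (pc ∷ pcol) = All-≔ π s pπ pc ∷ All-setColumn s col v pv pcol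

module ColumnSums where
  open import Data.Nat using (ℕ; zero; suc; _+_; _*_)
  open import Data.Nat.Properties using (*-zeroʳ)
  open import Data.Nat.Divisibility using (_∣_; _∣0; ∣m∣n⇒∣m+n; ∣n⇒∣m*n)
  open import Data.Nat.Tactic.RingSolver using (solve-∀)
  open import Data.Fin using (Fin; zero; suc)
  open import Data.Vec using ([]; _∷_)
  open import Data.Product using (_,_)
  open import Relation.Binary.PropositionalEquality
  open Rotation using (multiplicity)
  open Columns using (getColumn)

  columnSum : ∀ {t n} → Colored t n → Fin n → ℕ
  columnSum v s = multiplicity (getColumn s v)

  private
    sizesFrom : ℕ → ∀ {t n} → Colored t n → ℕ
    sizesFrom j [] = 0
    sizesFrom j (π ∷ v) = sizeFrom j π + sizesFrom j v

    tails : ∀ {t n} → Colored t (suc n) → Colored t n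
    tails [] = []
    tails ((_ ∷ π) ∷ v) = π ∷ tails v

    totalSize≡sizesFrom : ∀ {t n} (v : Colored t n) → totalSize v ≡ sizesFrom 0 v
    totalSize≡sizesFrom [] = refl
    totalSize≡sizesFrom (π ∷ v) = cong (size π +_) (totalSize≡sizesFrom v)

    sizesFrom-[] : ∀ j {t} (v : Colored t 0) → sizesFrom j v ≡ 0
    sizesFrom-[] j [] = refl
    sizesFrom-[] j ([] ∷ v) = sizesFrom-[] j v

    sizesFrom-∷ : ∀ j {t n} (v : Colored t (suc n)) → sizesFrom j v ≡ suc j * columnSum v zero + sizesFrom (suc j) (tails v)
    sizesFrom-∷ j [] = cong (_+ 0) (sym (*-zeroʳ j))
    sizesFrom-∷ j (((m , _) ∷ π) ∷ v) =
      trans (cong (suc j * m + sizeFrom (suc j) π +_) (sizesFrom-∷ j v))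
            (regroup (suc j) m (sizeFrom (suc j) π) (columnSum v zero) (sizesFrom (suc j) (tails v)))
      where
      regroup : ∀ a m s c u → a * m + s + (a * c + u) ≡ a * (m + c) + (s + u)
      regroup = solve-∀

    columnSum-tails : ∀ {t n} (v : Colored t (suc n)) s → columnSum (tails v) s ≡ columnSum v (suc s)
    columnSum-tails [] s = refl
    columnSum-tails ((_ ∷ π) ∷ v) s = cong (_ +_) (columnSum-tails v s)

    sizesFrom-divisible : ∀ d j {t n} (v : Colored t n) → (∀ s → d ∣ columnSum v s) → d ∣ sizesFrom j v
    sizesFrom-divisible d j {n = zero} v _ = subst (d ∣_) (sym (sizesFrom-[] j v)) (d ∣0)
    sizesFrom-divisible d j {n = suc n} v d∣columns = subst (d ∣_) (sym (sizesFrom-∷ j v))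
      (∣m∣n⇒∣m+n (∣n⇒∣m*n (suc j) (d∣columns zero))
        (sizesFrom-divisible d (suc j) (tails v) (λ s → subst (d ∣_) (sym (columnSum-tails v s)) (d∣columns (suc s)))))

  -- n = Σ_s (s + 1) · (number of parts of size s + 1 over all colours).
  totalSize-divisible : ∀ d {t n} (v : Colored t n) → (∀ s → d ∣ columnSum v s) → d ∣ totalSize v
  totalSize-divisible d v d∣columns = subst (d ∣_) (sym (totalSize≡sizesFrom v)) (sizesFrom-divisible d 0 v d∣columns)

module RStar where
  open import Data.Nat as ℕ using (ℕ; zero; suc; _∸_; _<_; _≤_; s≤s; z≤n; _/_)
  import Data.Nat.Properties as ℕ
  open import Data.Nat.DivMod using (m*n/n≡m; m≡m%n+[m/n]*n)
  open import Data.Integer using (ℤ; +_; _+_; _*_; _-_)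
  open import Data.Integer.Properties using (pos-+; pos-*)
  open import Data.Integer.Divisibility.Signed using (_∣?_)
  open import Relation.Nullary using (does)
  open import Data.Integer.Tactic.RingSolver using (solve-∀)
  import Data.Nat.Tactic.RingSolver as ℕ-Solver
  open import Data.List using (List; map; applyUpTo)
  open import Data.List.Properties using (map-upTo)
  open import Data.Vec using ([]; _∷_; toList)
  open import Data.Product using (_,_; ∃)
  open import Function using (_∘_)
  open import Relation.Binary.PropositionalEquality
  open ≡-Reasoning
  open Columns using (partWeight)

  sumℤBelow : (ℕ → ℤ) → ℕ → ℤ
  sumℤBelow g zero = + 0
  sumℤBelow g (suc k) = g 0 + sumℤBelow (g ∘ suc) k

  sumℤBelow-cong : ∀ {g g′ : ℕ → ℤ} k → (∀ i → i < k → g i ≡ g′ i) → sumℤBelow g k ≡ sumℤBelow g′ k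
  sumℤBelow-cong zero g≗g′ = refl
  sumℤBelow-cong (suc k) g≗g′ = cong₂ _+_ (g≗g′ 0 (s≤s z≤n)) (sumℤBelow-cong k (λ i i<k → g≗g′ (suc i) (s≤s i<k)))

  sumℤ-applyUpTo : ∀ (g : ℕ → ℤ) k → sumℤ (applyUpTo g k) ≡ sumℤBelow g k
  sumℤ-applyUpTo g zero = refl
  sumℤ-applyUpTo g (suc k) = cong (λ s → g 0 + s) (sumℤ-applyUpTo (g ∘ suc) k)

  double : ℕ → ℕ
  double zero = 0
  double (suc h) = suc (suc (double h))

  double≡*2 : ∀ h → double h ≡ h ℕ.* 2
  double≡*2 zero = refl
  double≡*2 (suc h) = cong (suc ∘ suc) (double≡*2 h)

  rstar-unfold : ∀ {t n} (v : Colored t n) → let f = nth (map numParts (toList v)) in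
    rstar v ≡ sumℤBelow (λ i → + suc i * (+ f i - + f (t ∸ suc i ∸ 1))) ((t ∸ 1) / 2)
  rstar-unfold {t} v = trans (cong sumℤ (map-upTo _ ((t ∸ 1) / 2))) (sumℤ-applyUpTo _ ((t ∸ 1) / 2))

  weighted : ℕ → (ℕ → ℕ) → ℕ → ℤ
  weighted a f zero = + 0
  weighted a f (suc k) = + a * + f 0 + weighted (suc a) (f ∘ suc) k

  mirrored : (ℕ → ℕ) → ℕ → ℤ
  mirrored f h = sumℤBelow (λ i → + f (double h ∸ i ∸ 1)) h

  -- Σ_{i<h} (a + i) (f(i) - f(2h - 1 - i)); for a = 1 and t = 2h + 1 this is r*.
  pairedDiff : ℕ → (ℕ → ℕ) → ℕ → ℤ
  pairedDiff a f h = sumℤBelow (λ i → + (a ℕ.+ i) * (+ f i - + f (double h ∸ i ∸ 1))) h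

  weighted-last : ∀ a f k → weighted a f (suc k) ≡ weighted a f k + + (a ℕ.+ k) * + f k
  weighted-last a f zero rewrite ℕ.+-identityʳ a = swap (+ a * + f 0)
    where
    swap : ∀ x → x + + 0 ≡ + 0 + x
    swap = solve-∀
  weighted-last a f (suc k) = begin
    + a * + f 0 + weighted (suc a) (f ∘ suc) (suc k)                ≡⟨ cong (λ w → + a * + f 0 + w) (weighted-last (suc a) (f ∘ suc) k) ⟩
    + a * + f 0 + (weighted (suc a) (f ∘ suc) k + + (suc a ℕ.+ k) * + f (suc k))
      ≡⟨ cong (λ c → + a * + f 0 + (weighted (suc a) (f ∘ suc) k + + c * + f (suc k))) (sym (ℕ.+-suc a k)) ⟩
    + a * + f 0 + (weighted (suc a) (f ∘ suc) k + + (a ℕ.+ suc k) * + f (suc k)) ≡⟨ assoc (+ a * + f 0) _ _ ⟩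
    + a * + f 0 + weighted (suc a) (f ∘ suc) k + + (a ℕ.+ suc k) * + f (suc k) ∎
    where
    assoc : ∀ x y z → x + (y + z) ≡ x + y + z
    assoc = solve-∀

  partWeight≡weighted : ∀ a {t n} (v : Colored t n) → + partWeight a v ≡ weighted a (nth (map numParts (toList v))) t
  partWeight≡weighted a [] = refl
  partWeight≡weighted a {suc t} (π ∷ v) = begin
    + (a ℕ.* numParts π ℕ.+ partWeight (suc a) v) ≡⟨ pos-+ (a ℕ.* numParts π) _ ⟩
    + (a ℕ.* numParts π) + + partWeight (suc a) v ≡⟨ cong₂ _+_ (pos-* a (numParts π)) (partWeight≡weighted (suc a) v) ⟩
    + a * + numParts π + weighted (suc a) (nth (map numParts (toList v))) t ∎

  private
    h≤double : ∀ h → h ≤ double h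
    h≤double zero = z≤n
    h≤double (suc h) = s≤s (ℕ.m≤n⇒m≤1+n (h≤double h))

    suc-∸-∸1 : ∀ D i → i < D → suc D ∸ i ∸ 1 ≡ suc (D ∸ i ∸ 1)
    suc-∸-∸1 (suc D) zero _ = refl
    suc-∸-∸1 (suc D) (suc i) (s≤s i<D) = suc-∸-∸1 D i i<D

  mirrored-suc : ∀ f h → mirrored f (suc h) ≡ + f (suc (double h)) + mirrored (f ∘ suc) h
  mirrored-suc f h = cong (λ m → + f (suc (double h)) + m) (sumℤBelow-cong h (λ i i<h →
    cong (+_ ∘ f) (suc-∸-∸1 (double h) i (ℕ.<-≤-trans i<h (h≤double h)))))

  pairedDiff-suc : ∀ a f h → let F = + f (suc (double h)) in
    pairedDiff a f (suc h) ≡ + a * (+ f 0 - F) + pairedDiff (suc a) (f ∘ suc) h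
  pairedDiff-suc a f h = cong₂ _+_ (cong (λ b → + b * (+ f 0 - + f (suc (double h)))) (ℕ.+-identityʳ a))
    (sumℤBelow-cong h (λ i i<h → cong₂ (λ c j → + c * (+ f (suc i) - + f j)) (ℕ.+-suc a i)
      (suc-∸-∸1 (double h) i (ℕ.<-≤-trans i<h (h≤double h)))))

  pairing : ∀ h a f → weighted a f (double h) + mirrored f h ≡ pairedDiff a f h + + (a ℕ.+ a ℕ.+ double h) * mirrored f h
  pairing zero a f = solve′ (+ (a ℕ.+ a ℕ.+ 0))
    where
    solve′ : ∀ c → + 0 + + 0 ≡ + 0 + c * + 0
    solve′ = solve-∀
  pairing (suc h) a f = begin
    + a * + f 0 + weighted (suc a) g (suc D) + mirrored f (suc h)
      ≡⟨ cong₂ (λ w m → + a * + f 0 + w + m) (weighted-last (suc a) g D) (mirrored-suc f h) ⟩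
    + a * + f 0 + (W′ + c * F) + (F + M′)
      ≡⟨ regroup₁ (+ a) (+ f 0) F W′ M′ c ⟩
    (W′ + M′) + (+ a * + f 0 + c * F + F)
      ≡⟨ cong (_+ (+ a * + f 0 + c * F + F)) (trans (pairing h (suc a) g) (cong (λ x → S′ + x * M′) coefficient)) ⟩
    (S′ + (+ a + c + + 1) * M′) + (+ a * + f 0 + c * F + F)
      ≡⟨ regroup₂ (+ a) (+ f 0) F M′ S′ c ⟩
    + a * (+ f 0 - F) + S′ + (+ a + c + + 1) * (F + M′)
      ≡⟨ cong₂ _+_ (pairedDiff-suc a f h) (cong₂ _*_ coefficient′ (mirrored-suc f h)) ⟨
    pairedDiff a f (suc h) + + (a ℕ.+ a ℕ.+ double (suc h)) * mirrored f (suc h) ∎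
    where
    D = double h
    g = f ∘ suc
    F = + f (suc D)
    c = + (suc a ℕ.+ D)
    W′ = weighted (suc a) g D
    M′ = mirrored g h
    S′ = pairedDiff (suc a) g h
    split : ∀ {x} → x ≡ a ℕ.+ (suc a ℕ.+ D) ℕ.+ 1 → + x ≡ + a + c + + 1
    split refl = trans (pos-+ (a ℕ.+ (suc a ℕ.+ D)) 1) (cong (_+ + 1) (pos-+ a (suc a ℕ.+ D)))
    coefficient : + (suc a ℕ.+ suc a ℕ.+ D) ≡ + a + c + + 1
    coefficient = split (identity a D)
      where
      identity : ∀ a D → suc a ℕ.+ suc a ℕ.+ D ≡ a ℕ.+ (suc a ℕ.+ D) ℕ.+ 1
      identity = ℕ-Solver.solve-∀
    coefficient′ : + (a ℕ.+ a ℕ.+ suc (suc D)) ≡ + a + c + + 1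
    coefficient′ = split (identity a D)
      where
      identity : ∀ a D → a ℕ.+ a ℕ.+ suc (suc D) ≡ a ℕ.+ (suc a ℕ.+ D) ℕ.+ 1
      identity = ℕ-Solver.solve-∀
    regroup₁ : ∀ A F0 F W M c → A * F0 + (W + c * F) + (F + M) ≡ (W + M) + (A * F0 + c * F + F)
    regroup₁ = solve-∀
    regroup₂ : ∀ A F0 F M S c → (S + (A + c + + 1) * M) + (A * F0 + c * F + F) ≡ A * (F0 - F) + S + (A + c + + 1) * (F + M)
    regroup₂ = solve-∀

  rstar-congruence : ∀ h {n} (v : Colored (suc (double h)) n) →
    ∃ λ X → rstar v + + suc (double h) * X ≡ + partWeight 1 v
  rstar-congruence h v = X , (begin
    rstar v + + suc D * X                 ≡⟨ cong (λ r → r + + suc D * X) (trans (rstar-unfold v) (cong (sumℤBelow _) half)) ⟩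
    pairedDiff 1 f h + + suc D * X        ≡⟨ cancel (weighted 1 f D) (mirrored f h) (pairedDiff 1 f h) (+ suc D) (+ f D) paired ⟩
    weighted 1 f D + + suc D * + f D      ≡⟨ sym (weighted-last 1 f D) ⟩
    weighted 1 f (suc D)                  ≡⟨ sym (partWeight≡weighted 1 v) ⟩
    + partWeight 1 v                      ∎)
    where
    D = double h
    f = nth (map numParts (toList v))
    X = mirrored f h + + f D
    half : D / 2 ≡ h
    half = trans (cong (_/ 2) (double≡*2 h)) (m*n/n≡m h 2)
    T+1 : + (1 ℕ.+ 1 ℕ.+ D) ≡ + suc D + + 1
    T+1 = trans (cong +_ (ℕ.+-comm 1 (suc D))) (pos-+ (suc D) 1)
    paired : weighted 1 f D + mirrored f h ≡ pairedDiff 1 f h + (+ suc D + + 1) * mirrored f h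
    paired = trans (pairing h 1 f) (cong (λ c → pairedDiff 1 f h + c * mirrored f h) T+1)
    cancel : ∀ W M R c F → W + M ≡ R + (c + + 1) * M → R + c * (M + F) ≡ W + c * F
    cancel W M R c F eq = begin
      R + c * (M + F)                ≡⟨ regroup₁ R c M F ⟩
      (R + (c + + 1) * M) - M + c * F ≡⟨ cong (λ x → x - M + c * F) (sym eq) ⟩
      (W + M) - M + c * F            ≡⟨ regroup₂ W M c F ⟩
      W + c * F                      ∎
      where
      regroup₁ : ∀ R c M F → R + c * (M + F) ≡ (R + (c + + 1) * M) - M + c * F
      regroup₁ = solve-∀
      regroup₂ : ∀ W M c F → (W + M) - M + c * F ≡ W + c * F
      regroup₂ = solve-∀

  rstarMod-numParts : ∀ i {t n} (v w : Colored t n) → map numParts (toList w) ≡ map numParts (toList v) →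
    rstarMod i t w ≡ rstarMod i t v
  rstarMod-numParts i {t} v w same = cong (λ r → does (+ t ∣? (r - + i))) (begin
    rstar w                                   ≡⟨ rstar-unfold w ⟩
    sumℤBelow (term (map numParts (toList w))) ((t ∸ 1) / 2) ≡⟨ cong (λ ls → sumℤBelow (term ls) ((t ∸ 1) / 2)) same ⟩
    sumℤBelow (term (map numParts (toList v))) ((t ∸ 1) / 2) ≡⟨ rstar-unfold v ⟨
    rstar v                                   ∎)
    where
    term : List ℕ → ℕ → ℤ
    term ls i = + suc i * (+ nth ls i - + nth ls (t ∸ suc i ∸ 1))

  odd⇒suc-double : ∀ t → t ℕ.% 2 ≡ 1 → ∃ λ h → t ≡ suc (double h)
  odd⇒suc-double t t-odd = t / 2 , trans (m≡m%n+[m/n]*n t 2) (cong₂ ℕ._+_ t-odd (sym (double≡*2 (t / 2))))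

module Residues (t : ℕ) .{{_ : NonZero t}} where
  open import Data.Nat as ℕ using (ℕ; _<_; _≤_; _∸_; _≡ᵇ_)
  import Data.Nat.Properties as ℕ
  open import Data.Nat.DivMod using (m<n⇒m%n≡m)
  import Data.Nat.Divisibility as ℕ
  open import Data.Integer using (+_; _+_; _-_; _*_; -_)
  open import Data.Integer.Properties using (m-n≡m⊖n; ⊖-≥; +-inverseʳ)
  open import Data.Integer.DivMod using (_%ℕ_; _/ℕ_; n%ℕd<d; a≡a%ℕn+[a/ℕn]*n)
  open import Data.Integer.Divisibility.Signed using (_∣_; _∣?_; ∣⇒∣ᵤ; ∣m∣n⇒∣m+n; ∣m+n∣n⇒∣m; ∣-refl; ∣m⇒∣-m; ∣m⇒∣m*n; ∣ᵤ⇒∣)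
  open import Data.Integer.Tactic.RingSolver using (solve-∀)
  open import Data.Bool using (T; T?)
  open import Data.Sum using (inj₁; inj₂)
  open import Function.Bundles using (_⇔_; mk⇔; Equivalence)
  open import Relation.Binary.PropositionalEquality
  open import Relation.Nullary using (does)
  open import Relation.Nullary.Decidable using (does-⇔)
  open Counting using (sumBelow; sumBelow-cong; indicator)

  ∣-shift : ∀ {x y} z → x ≡ y + + t * z → (+ t ∣ x ⇔ + t ∣ y)
  ∣-shift {x} {y} z eq = mk⇔ (λ t∣x → ∣m+n∣n⇒∣m (subst (+ t ∣_) eq t∣x) t∣tz) (λ t∣y → subst (+ t ∣_) (sym eq) (∣m∣n⇒∣m+n t∣y t∣tz))
    where
    t∣tz : + t ∣ + t * z
    t∣tz = ∣m⇒∣m*n z ∣-refl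

  private
    ∣-difference⇒≤ : ∀ {k i} → i ≤ k → k < t → + t ∣ (+ k - + i) → k ≤ i
    ∣-difference⇒≤ {k} {i} i≤k k<t t∣k-i = ℕ.m∸n≡0⇒m≤n (trans (sym (m<n⇒m%n≡m k∸i<t)) (ℕ.n∣m⇒m%n≡0 (k ∸ i) t t∣k∸i))
      where
      k∸i<t : k ∸ i < t
      k∸i<t = ℕ.≤-<-trans (ℕ.m∸n≤m k i) k<t
      t∣k∸i : t ℕ.∣ (k ∸ i)
      t∣k∸i = ∣⇒∣ᵤ (subst (+ t ∣_) (trans (m-n≡m⊖n k i) (⊖-≥ i≤k)) t∣k-i)

  ∣-difference⇒≡ : ∀ {k i} → k < t → i < t → + t ∣ (+ k - + i) → k ≡ i
  ∣-difference⇒≡ {k} {i} k<t i<t t∣k-i with ℕ.≤-total i k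
  ... | inj₁ i≤k = ℕ.≤-antisym (∣-difference⇒≤ i≤k k<t t∣k-i) i≤k
  ... | inj₂ k≤i = ℕ.≤-antisym k≤i (∣-difference⇒≤ k≤i i<t (subst (+ t ∣_) (negate (+ k) (+ i)) (∣m⇒∣-m t∣k-i)))
    where
    negate : ∀ a b → - (a - b) ≡ b - a
    negate = solve-∀

  residue-class : ∀ r {i} → i < t → does (+ t ∣? (r - + i)) ≡ (i ≡ᵇ r %ℕ t)
  residue-class r {i} i<t = does-⇔ (mk⇔ to from) (+ t ∣? (r - + i)) (T? (i ≡ᵇ k))
    where
    k = r %ℕ t
    q = r /ℕ t
    shift : r - + i ≡ (+ k - + i) + + t * q
    shift = trans (cong (_- + i) (a≡a%ℕn+[a/ℕn]*n r t)) (regroup (+ k) q (+ i) (+ t))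
      where
      regroup : ∀ k q i t → (k + q * t) - i ≡ (k - i) + t * q
      regroup = solve-∀
    to : + t ∣ (r - + i) → T (i ≡ᵇ k)
    to t∣r-i = ℕ.≡⇒≡ᵇ i k (sym (∣-difference⇒≡ (n%ℕd<d r t) i<t (Equivalence.to (∣-shift q shift) t∣r-i)))
    from : T (i ≡ᵇ k) → + t ∣ (r - + i)
    from i≡k = Equivalence.from (∣-shift q shift)
      (subst (λ j → + t ∣ (+ j - + i)) (ℕ.≡ᵇ⇒≡ i k i≡k) (subst (+ t ∣_) (sym (+-inverseʳ (+ i))) (∣ᵤ⇒∣ (t ℕ.∣0))))

  residue-unique : ∀ r → sumBelow (λ i → indicator (does (+ t ∣? (r - + i)))) t ≡ 1
  residue-unique r = trans (sumBelow-cong t (λ i i<t → cong indicator (residue-class r i<t)))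
                           (Counting.sumBelow-indicator-≡ᵇ t (n%ℕd<d r t))

module ModularInverse (p : ℕ) .{{_ : NonZero p}} where
  open import Data.Nat using (ℕ; zero; suc; _+_; _*_; _∸_; _≤_; _<_; z≤n; _%_; NonZero; nonTrivial⇒n>1)
  open import Data.Nat.Properties using (_≟_; <⇒≤)
  open import Data.Nat.DivMod using (m%n<n; m%n%n≡m%n; %-distribˡ-*; [m+kn]%n≡m%n; m<n⇒m%n≡m)
  open import Data.Nat.Divisibility using (_∣_; m%n≡0⇒n∣m)
  open import Data.Nat.Primality using (Prime; prime⇒nonTrivial)
  open import Data.Nat.Coprimality using (prime⇒coprime; coprime-Bézout)
  open import Data.Nat.GCD using (module Bézout)
  open import Data.Nat.Tactic.RingSolver using (solve-∀)
  open import Data.Fin using (Fin; toℕ; fromℕ<)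
  open import Data.Fin.Properties using (any?; toℕ<n; toℕ-fromℕ<)
  open import Data.Product using (_,_; ∃)
  open import Data.Empty using (⊥-elim)
  open import Relation.Binary.PropositionalEquality
  open import Relation.Nullary using (¬_; yes; no)
  open ≡-Reasoning

  inverse : ℕ → ℕ
  inverse a with any? (λ (d : Fin p) → (toℕ d * a) % p ≟ 1)
  ... | yes (d , _) = toℕ d
  ... | no _ = 0

  inverse≤p : ∀ a → inverse a ≤ p
  inverse≤p a with any? (λ (d : Fin p) → (toℕ d * a) % p ≟ 1)
  ... | yes (d , _) = <⇒≤ (toℕ<n d)
  ... | no _ = z≤n

  private
    bézout-inverse : ∀ {r} → 1 < p → Bézout.Identity 1 p r → ∃ λ e → (e * r) % p ≡ 1
    bézout-inverse {r} 1<p (Bézout.-+ x y eq) = y , (begin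
      (y * r) % p     ≡⟨ cong (_% p) (sym eq) ⟩
      (1 + x * p) % p ≡⟨ [m+kn]%n≡m%n 1 x p ⟩
      1 % p           ≡⟨ m<n⇒m%n≡m 1<p ⟩
      1               ∎)
    bézout-inverse {r} 1<p (Bézout.+- x y eq) = (p ∸ 1) * y , (begin
      ((p ∸ 1) * y * r) % p               ≡⟨ sym ([m+kn]%n≡m%n _ 1 p) ⟩
      ((p ∸ 1) * y * r + 1 * p) % p       ≡⟨ cong (_% p) (rearrange p eq) ⟩
      (1 + ((p ∸ 1) * x) * p) % p         ≡⟨ [m+kn]%n≡m%n 1 ((p ∸ 1) * x) p ⟩
      1 % p                               ≡⟨ m<n⇒m%n≡m 1<p ⟩
      1                                   ∎)
      where
      rearrange : ∀ p .{{_ : NonZero p}} → 1 + y * r ≡ x * p → (p ∸ 1) * y * r + 1 * p ≡ 1 + ((p ∸ 1) * x) * p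
      rearrange (suc D) eq = begin
        D * y * r + 1 * suc D   ≡⟨ regroup₁ D y r ⟩
        1 + D * (1 + y * r)     ≡⟨ cong (λ z → 1 + D * z) eq ⟩
        1 + D * (x * suc D)     ≡⟨ regroup₂ D x ⟩
        1 + (D * x) * suc D     ∎
        where
        regroup₁ : ∀ D y r → D * y * r + 1 * suc D ≡ 1 + D * (1 + y * r)
        regroup₁ = solve-∀
        regroup₂ : ∀ D x → 1 + D * (x * suc D) ≡ 1 + (D * x) * suc D
        regroup₂ = solve-∀

    inverse-exists : Prime p → ∀ a → ¬ p ∣ a → ∃ λ (d : Fin p) → (toℕ d * a) % p ≡ 1
    inverse-exists p-prime a p∤a with a % p in a%p≡r
    ... | zero = ⊥-elim (p∤a (m%n≡0⇒n∣m a p a%p≡r))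
    ... | suc r′ with bézout-inverse (nonTrivial⇒n>1 p {{prime⇒nonTrivial p-prime}}) (coprime-Bézout (prime⇒coprime p-prime r<p))
      where
      r<p : suc r′ < p
      r<p = subst (_< p) a%p≡r (m%n<n a p)
    ... | e , e*r≡1 = fromℕ< (m%n<n e p) , (begin
      (toℕ (fromℕ< (m%n<n e p)) * a) % p ≡⟨ cong (λ d → (d * a) % p) (toℕ-fromℕ< (m%n<n e p)) ⟩
      (e % p * a) % p                   ≡⟨ %-distribˡ-* (e % p) a p ⟩
      (e % p % p * (a % p)) % p         ≡⟨ cong₂ (λ u w → (u * w) % p) (m%n%n≡m%n e p) a%p≡r ⟩
      (e % p * suc r′) % p              ≡⟨ cong (λ w → (e % p * w) % p) (sym r%p≡r) ⟩
      (e % p * (suc r′ % p)) % p        ≡⟨ sym (%-distribˡ-* e (suc r′) p) ⟩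
      (e * suc r′) % p                  ≡⟨ e*r≡1 ⟩
      1                                 ∎)
      where
      r%p≡r : suc r′ % p ≡ suc r′
      r%p≡r = trans (cong (_% p) (sym a%p≡r)) (trans (m%n%n≡m%n a p) a%p≡r)

  inverse-correct : Prime p → ∀ a → ¬ p ∣ a → (inverse a * a) % p ≡ 1
  inverse-correct p-prime a p∤a with any? (λ (d : Fin p) → (toℕ d * a) % p ≟ 1)
  ... | yes (d , d*a≡1) = d*a≡1
  ... | no none = ⊥-elim (none (inverse-exists p-prime a p∤a))

module Overline where
  open import Data.Nat using (zero; suc; _+_; _*_)
  open import Data.Nat.Properties using (*-zeroʳ)
  open import Data.Maybe as Maybe using (Maybe; just; nothing; maybe′; fromMaybe)
  open import Data.Bool using (Bool; true; false; _∧_; not)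
  open import Data.Bool.Properties using (not-involutive)
  open import Data.Vec using (Vec; []; _∷_; toList)
  open import Data.Vec.Relation.Unary.All using (All; []; _∷_)
  open import Data.List as List using (map)
  open import Data.List.Membership.Propositional using (_∈_)
  open import Data.Product using (_,_)
  open import Relation.Binary.PropositionalEquality
  open Enumeration using (cells-overline)

  -- The first cell of positive multiplicity holds the smallest part.
  flipSmallest : ∀ {k} → Vec Cell k → Maybe (Vec Cell k)
  flipSmallest [] = nothing
  flipSmallest ((zero , b) ∷ π) = Maybe.map ((zero , b) ∷_) (flipSmallest π)
  flipSmallest ((suc m , b) ∷ π) = just ((suc m , not b) ∷ π)

  smallestOverlined : ∀ {k} → Vec Cell k → Bool
  smallestOverlined [] = false
  smallestOverlined ((zero , _) ∷ π) = smallestOverlined π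
  smallestOverlined ((suc _ , b) ∷ _) = b

  flipFirst : ∀ {t n} → Colored t n → Maybe (Colored t n)
  flipFirst [] = nothing
  flipFirst (π ∷ v) = maybe′ (λ π′ → just (π′ ∷ v)) (Maybe.map (π ∷_) (flipFirst v)) (flipSmallest π)

  firstOverlined : ∀ {t n} → Colored t n → Bool
  firstOverlined [] = false
  firstOverlined (π ∷ v) = maybe′ (λ _ → smallestOverlined π) (firstOverlined v) (flipSmallest π)

  flip : ∀ {t n} → Colored t n → Colored t n
  flip v = fromMaybe v (flipFirst v)

  flipSmallest-involutive : ∀ {k} (π π′ : Vec Cell k) → flipSmallest π ≡ just π′ → flipSmallest π′ ≡ just π
  flipSmallest-involutive ((zero , b) ∷ π) _ eq with flipSmallest π in eq′
  flipSmallest-involutive ((zero , b) ∷ π) _ refl | just π′ rewrite flipSmallest-involutive π π′ eq′ = refl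
  flipSmallest-involutive ((suc m , b) ∷ π) _ refl rewrite not-involutive b = refl

  flipSmallest-overlined : ∀ {k} (π π′ : Vec Cell k) → flipSmallest π ≡ just π′ → smallestOverlined π′ ≡ not (smallestOverlined π)
  flipSmallest-overlined ((zero , b) ∷ π) _ eq with flipSmallest π in eq′
  flipSmallest-overlined ((zero , b) ∷ π) _ refl | just π′ = flipSmallest-overlined π π′ eq′
  flipSmallest-overlined ((suc m , b) ∷ π) _ refl = refl

  flipSmallest-numParts : ∀ {k} (π π′ : Vec Cell k) → flipSmallest π ≡ just π′ → numParts π′ ≡ numParts π
  flipSmallest-numParts ((zero , b) ∷ π) _ eq with flipSmallest π in eq′
  flipSmallest-numParts ((zero , b) ∷ π) _ refl | just π′ = flipSmallest-numParts π π′ eq′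
  flipSmallest-numParts ((suc m , b) ∷ π) _ refl = refl

  flipSmallest-sizeFrom : ∀ {k} j (π π′ : Vec Cell k) → flipSmallest π ≡ just π′ → sizeFrom j π′ ≡ sizeFrom j π
  flipSmallest-sizeFrom j ((zero , b) ∷ π) _ eq with flipSmallest π in eq′
  flipSmallest-sizeFrom j ((zero , b) ∷ π) _ refl | just π′ = cong (suc j * 0 +_) (flipSmallest-sizeFrom (suc j) π π′ eq′)
  flipSmallest-sizeFrom j ((suc m , b) ∷ π) _ refl = refl

  -- Overlining is allowed for every part size that occurs.
  flipSmallest-valid : ∀ {k} j (π π′ : Vec Cell k) → flipSmallest π ≡ just π′ →
    validFrom overpartitionCell j π′ ≡ validFrom overpartitionCell j π
  flipSmallest-valid j ((zero , b) ∷ π) _ eq with flipSmallest π in eq′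
  flipSmallest-valid j ((zero , b) ∷ π) _ refl | just π′ = cong (overpartitionCell (suc j) (zero , b) ∧_) (flipSmallest-valid (suc j) π π′ eq′)
  flipSmallest-valid j ((suc m , true) ∷ π) _ refl = refl
  flipSmallest-valid j ((suc m , false) ∷ π) _ refl = refl

  flipSmallest-empty : ∀ {k} j (π : Vec Cell k) → flipSmallest π ≡ nothing → sizeFrom j π ≡ 0
  flipSmallest-empty j [] eq = refl
  flipSmallest-empty j ((zero , b) ∷ π) eq with flipSmallest π in eq′
  flipSmallest-empty j ((zero , b) ∷ π) refl | nothing = trans (cong (_+ sizeFrom (suc j) π) (*-zeroʳ (suc j))) (flipSmallest-empty (suc j) π eq′)

  flipSmallest-cells : ∀ {n k} (π π′ : Vec Cell k) → flipSmallest π ≡ just π′ → All (_∈ cells n) π → All (_∈ cells n) π′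
  flipSmallest-cells ((zero , b) ∷ π) _ eq _ with flipSmallest π in eq′
  flipSmallest-cells {n} ((zero , b) ∷ π) _ refl (c∈ ∷ π∈) | just π′ = c∈ ∷ flipSmallest-cells {n} π π′ eq′ π∈
  flipSmallest-cells {n} ((suc m , b) ∷ π) _ refl (c∈ ∷ π∈) = cells-overline {n} (not b) c∈ ∷ π∈

  flipFirst-involutive : ∀ {t n} (v w : Colored t n) → flipFirst v ≡ just w → flipFirst w ≡ just v
  flipFirst-involutive (π ∷ v) w eq with flipSmallest π in eq₁
  flipFirst-involutive (π ∷ v) _ refl | just π′ rewrite flipSmallest-involutive π π′ eq₁ = refl
  flipFirst-involutive (π ∷ v) w eq | nothing with flipFirst v in eq₂
  flipFirst-involutive (π ∷ v) _ refl | nothing | just w rewrite eq₁ | flipFirst-involutive v w eq₂ = refl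

  flipFirst-overlined : ∀ {t n} (v w : Colored t n) → flipFirst v ≡ just w → firstOverlined w ≡ not (firstOverlined v)
  flipFirst-overlined (π ∷ v) w eq with flipSmallest π in eq₁
  flipFirst-overlined (π ∷ v) _ refl | just π′ rewrite flipSmallest-involutive π π′ eq₁ = flipSmallest-overlined π π′ eq₁
  flipFirst-overlined (π ∷ v) w eq | nothing with flipFirst v in eq₂
  flipFirst-overlined (π ∷ v) _ refl | nothing | just w rewrite eq₁ = flipFirst-overlined v w eq₂

  flipFirst-numParts : ∀ {t n} (v w : Colored t n) → flipFirst v ≡ just w →
    map numParts (toList w) ≡ map numParts (toList v)
  flipFirst-numParts (π ∷ v) w eq with flipSmallest π in eq₁
  flipFirst-numParts (π ∷ v) _ refl | just π′ = cong₂ List._∷_ (flipSmallest-numParts π π′ eq₁) refl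
  flipFirst-numParts (π ∷ v) w eq | nothing with flipFirst v in eq₂
  flipFirst-numParts (π ∷ v) _ refl | nothing | just w = cong₂ List._∷_ refl (flipFirst-numParts v w eq₂)

  flipFirst-totalSize : ∀ {t n} (v w : Colored t n) → flipFirst v ≡ just w → totalSize w ≡ totalSize v
  flipFirst-totalSize (π ∷ v) w eq with flipSmallest π in eq₁
  flipFirst-totalSize (π ∷ v) _ refl | just π′ = cong (_+ totalSize v) (flipSmallest-sizeFrom 0 π π′ eq₁)
  flipFirst-totalSize (π ∷ v) w eq | nothing with flipFirst v in eq₂
  flipFirst-totalSize (π ∷ v) _ refl | nothing | just w = cong (size π +_) (flipFirst-totalSize v w eq₂)

  flipFirst-valid : ∀ {t n} (v w : Colored t n) → flipFirst v ≡ just w →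
    allValid overpartitionCell w ≡ allValid overpartitionCell v
  flipFirst-valid (π ∷ v) w eq with flipSmallest π in eq₁
  flipFirst-valid (π ∷ v) _ refl | just π′ = cong (_∧ allValid overpartitionCell v) (flipSmallest-valid 0 π π′ eq₁)
  flipFirst-valid (π ∷ v) w eq | nothing with flipFirst v in eq₂
  flipFirst-valid (π ∷ v) _ refl | nothing | just w = cong (validFrom overpartitionCell 0 π ∧_) (flipFirst-valid v w eq₂)

  flipFirst-empty : ∀ {t n} (v : Colored t n) → flipFirst v ≡ nothing → totalSize v ≡ 0
  flipFirst-empty [] eq = refl
  flipFirst-empty (π ∷ v) eq with flipSmallest π in eq₁
  flipFirst-empty (π ∷ v) eq | nothing with flipFirst v in eq₂
  flipFirst-empty (π ∷ v) refl | nothing | nothing = cong₂ _+_ (flipSmallest-empty 0 π eq₁) (flipFirst-empty v eq₂)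

  flipFirst-cells : ∀ {t n} (v w : Colored t n) → flipFirst v ≡ just w → All (All (_∈ cells n)) v → All (All (_∈ cells n)) w
  flipFirst-cells (π ∷ v) w eq _ with flipSmallest π in eq₁
  flipFirst-cells {n = n} (π ∷ v) _ refl (π∈ ∷ v∈) | just π′ = flipSmallest-cells {n} π π′ eq₁ π∈ ∷ v∈
  flipFirst-cells (π ∷ v) w eq _ | nothing with flipFirst v in eq₂
  flipFirst-cells (π ∷ v) _ refl (π∈ ∷ v∈) | nothing | just w = π∈ ∷ flipFirst-cells v w eq₂ v∈

  flip-involutive : ∀ {t n} (v : Colored t n) → flip (flip v) ≡ v
  flip-involutive v with flipFirst v in eq
  ... | nothing rewrite eq = refl
  ... | just w rewrite flipFirst-involutive v w eq = refl

module Classes where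
  open import Data.Nat using (ℕ)
  open import Data.Bool using (Bool; _∧_)

  inClass : Kind → ℕ → (t : ℕ) → ∀ {n} → Colored t n → Bool
  inClass K i t {n} v = isColored K t n v ∧ rstarMod i t v

module Shift (h : ℕ) where
  open import Data.Nat as ℕ using (ℕ; zero; suc; _+_; _*_; _∸_)
  import Data.Nat.Properties as ℕ
  open import Data.Nat.Divisibility using (_∣_; _∣?_)
  open import Data.Nat.Tactic.RingSolver using (solve-∀)
  open import Data.Bool using (Bool; true; false; _∧_)
  open import Data.Fin as Fin using (Fin; zero; suc; toℕ)
  open import Data.Maybe as Maybe using (Maybe; just; nothing; maybe′)
  open import Data.Vec.Relation.Unary.All using (All)
  open import Data.Product using (_,_; ∃)
  open import Data.Empty using (⊥-elim)
  open import Function using (_∘_)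
  open import Relation.Binary.PropositionalEquality
  open import Relation.Nullary using (¬_; yes; no)
  open ≡-Reasoning
  open Rotation using (rotateBy; rotateBy-+; rotateBy-length; All-rotateBy; multiplicity; multiplicity-rotateBy; colourWeight; colourWeight-rotateBy)
  open Columns
  open ColumnSums using (columnSum; totalSize-divisible)
  open RStar using (double)

  T : ℕ
  T = suc (double h)

  open ModularInverse T using (inverse; inverse≤p; inverse-correct)

  rotateColumn : (ℕ → ℕ) → ∀ {n} → Fin n → Colored T n → Colored T n
  rotateColumn amount s v = setColumn s (rotateBy (amount (columnSum v s)) (getColumn s v)) v

  columnSum-rotateColumn : ∀ amount {n} s (v : Colored T n) j → columnSum (rotateColumn amount s v) j ≡ columnSum v j
  columnSum-rotateColumn amount s v j with j Fin.≟ s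
  ... | yes refl = trans (cong multiplicity (getColumn-setColumn s (rotateBy d (getColumn s v)) v)) (multiplicity-rotateBy d (getColumn s v))
    where d = amount (columnSum v s)
  ... | no j≢s = cong multiplicity (getColumn-setColumn′ (rotateBy (amount (columnSum v s)) (getColumn s v)) v j≢s)

  rotateColumn-cancel : ∀ amount amount′ → (∀ c → amount′ c + amount c ≡ T) → ∀ {n} s (v : Colored T n) →
    rotateColumn amount′ s (rotateColumn amount s v) ≡ v
  rotateColumn-cancel amount amount′ cancel s v = begin
    setColumn s (rotateBy (amount′ (columnSum w s)) (getColumn s w)) w
      ≡⟨ cong (λ c → setColumn s (rotateBy (amount′ c) (getColumn s w)) w) (columnSum-rotateColumn amount s v s) ⟩
    setColumn s (rotateBy d′ (getColumn s w)) w
      ≡⟨ cong (λ col′ → setColumn s (rotateBy d′ col′) w) (getColumn-setColumn s (rotateBy d col) v) ⟩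
    setColumn s (rotateBy d′ (rotateBy d col)) w
      ≡⟨ cong (λ col′ → setColumn s col′ w) full-turn ⟩
    setColumn s col w
      ≡⟨ setColumn-setColumn s col (rotateBy d col) v ⟩
    setColumn s col v
      ≡⟨ setColumn-getColumn s v ⟩
    v ∎
    where
    col = getColumn s v
    d = amount (columnSum v s)
    d′ = amount′ (columnSum v s)
    w = rotateColumn amount s v
    full-turn : rotateBy d′ (rotateBy d col) ≡ col
    full-turn = trans (sym (rotateBy-+ d′ d col)) (trans (cong (λ e → rotateBy e col) (cancel (columnSum v s))) (rotateBy-length col))

  All-rotateColumn : ∀ {P : Cell → Set} amount {n} s (v : Colored T n) → All (All P) v → All (All P) (rotateColumn amount s v)
  All-rotateColumn amount s v pv = All-setColumn s _ v pv (All-rotateBy (amount (columnSum v s)) (All-getColumn s v pv))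

  allValid-rotateColumn : ∀ K amount {n} s (v : Colored T n) → allValid K v ≡ true → allValid K (rotateColumn amount s v) ≡ true
  allValid-rotateColumn K amount s v valid =
    allValid-setColumn K s _ v valid (All-rotateBy (amount (columnSum v s)) (allValid-getColumn K s v valid))

  totalSize-rotateColumn : ∀ amount {n} s (v : Colored T n) → totalSize (rotateColumn amount s v) ≡ totalSize v
  totalSize-rotateColumn amount s v = ℕ.+-cancelʳ-≡ _ _ _ (trans (totalSize-setColumn s (rotateBy d col) v)
    (cong (λ m → totalSize v + suc (toℕ s) * m) (multiplicity-rotateBy d col)))
    where
    col = getColumn s v
    d = amount (columnSum v s)

  partWeight-rotateColumn : ∀ amount {n} s (v : Colored T n) → let c = columnSum v s in
    ∃ λ X → partWeight 1 (rotateColumn amount s v) + amount c * c ≡ partWeight 1 v + T * X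
  partWeight-rotateColumn amount s v with colourWeight-rotateBy (amount (columnSum v s)) (getColumn s v)
  ... | X , rotated = X , ℕ.+-cancelʳ-≡ (colourWeight 1 col) _ _ (begin
    partWeight 1 w + d * c + colourWeight 1 col           ≡⟨ regroup₁ (partWeight 1 w) (d * c) _ ⟩
    partWeight 1 w + colourWeight 1 col + d * c           ≡⟨ cong (_+ d * c) (partWeight-setColumn 1 s (rotateBy d col) v) ⟩
    partWeight 1 v + colourWeight 1 (rotateBy d col) + d * c ≡⟨ ℕ.+-assoc (partWeight 1 v) _ _ ⟩
    partWeight 1 v + (colourWeight 1 (rotateBy d col) + d * c) ≡⟨ cong (partWeight 1 v +_) rotated ⟩
    partWeight 1 v + (colourWeight 1 col + T * X)         ≡⟨ regroup₂ (partWeight 1 v) _ (T * X) ⟩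
    partWeight 1 v + T * X + colourWeight 1 col           ∎)
    where
    col = getColumn s v
    c = columnSum v s
    d = amount c
    w = rotateColumn amount s v
    regroup₁ : ∀ a b c → a + b + c ≡ a + c + b
    regroup₁ = solve-∀
    regroup₂ : ∀ a b c → a + (b + c) ≡ a + c + b
    regroup₂ = solve-∀

  firstNonDivisible : ∀ {n} → (Fin n → ℕ) → Maybe (Fin n)
  firstNonDivisible {zero} f = nothing
  firstNonDivisible {suc n} f with T ∣? f zero
  ... | yes _ = Maybe.map suc (firstNonDivisible (f ∘ suc))
  ... | no _ = just zero

  firstNonDivisible-cong : ∀ {n} {f g : Fin n → ℕ} → (∀ j → f j ≡ g j) → firstNonDivisible f ≡ firstNonDivisible g
  firstNonDivisible-cong {zero} f≗g = refl
  firstNonDivisible-cong {suc n} {f} {g} f≗g with T ∣? f zero | T ∣? g zero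
  ... | yes _ | yes _ = cong (Maybe.map suc) (firstNonDivisible-cong (f≗g ∘ suc))
  ... | no _ | no _ = refl
  ... | yes T∣f0 | no T∤g0 = ⊥-elim (T∤g0 (subst (T ∣_) (f≗g zero) T∣f0))
  ... | no T∤f0 | yes T∣g0 = ⊥-elim (T∤f0 (subst (T ∣_) (sym (f≗g zero)) T∣g0))

  firstNonDivisible-nothing : ∀ {n} (f : Fin n → ℕ) → firstNonDivisible f ≡ nothing → ∀ j → T ∣ f j
  firstNonDivisible-nothing {suc n} f eq j with T ∣? f zero
  firstNonDivisible-nothing {suc n} f () j | no _
  firstNonDivisible-nothing {suc n} f eq zero | yes T∣f0 = T∣f0
  firstNonDivisible-nothing {suc n} f eq (suc j) | yes _ with firstNonDivisible (f ∘ suc) in eq′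
  ... | nothing = firstNonDivisible-nothing (f ∘ suc) eq′ j

  firstNonDivisible-just : ∀ {n} (f : Fin n → ℕ) {s} → firstNonDivisible f ≡ just s → ¬ T ∣ f s
  firstNonDivisible-just {suc n} f eq with T ∣? f zero
  firstNonDivisible-just {suc n} f refl | no T∤f0 = T∤f0
  firstNonDivisible-just {suc n} f eq | yes _ with firstNonDivisible (f ∘ suc) in eq′
  firstNonDivisible-just {suc n} f refl | yes _ | just s = firstNonDivisible-just (f ∘ suc) eq′

  shiftBy : (ℕ → ℕ) → ∀ {n} → Colored T n → Colored T n
  shiftBy amount v = maybe′ (λ s → rotateColumn amount s v) v (firstNonDivisible (columnSum v))

  shiftBy-cancel : ∀ amount amount′ → (∀ c → amount′ c + amount c ≡ T) → ∀ {n} (v : Colored T n) →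
    shiftBy amount′ (shiftBy amount v) ≡ v
  shiftBy-cancel amount amount′ cancel v with firstNonDivisible (columnSum v) in eq
  ... | nothing rewrite eq = refl
  ... | just s rewrite firstNonDivisible-cong (columnSum-rotateColumn amount s v) | eq = rotateColumn-cancel amount amount′ cancel s v

  All-shiftBy : ∀ {P : Cell → Set} amount {n} (v : Colored T n) → All (All P) v → All (All P) (shiftBy amount v)
  All-shiftBy amount v pv with firstNonDivisible (columnSum v)
  ... | nothing = pv
  ... | just s = All-rotateColumn amount s v pv

  allValid-shiftBy : ∀ K amount {n} (v : Colored T n) → allValid K v ≡ true → allValid K (shiftBy amount v) ≡ true
  allValid-shiftBy K amount v valid with firstNonDivisible (columnSum v)
  ... | nothing = valid
  ... | just s = allValid-rotateColumn K amount s v valid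

  totalSize-shiftBy : ∀ amount {n} (v : Colored T n) → totalSize (shiftBy amount v) ≡ totalSize v
  totalSize-shiftBy amount v with firstNonDivisible (columnSum v)
  ... | nothing = refl
  ... | just s = totalSize-rotateColumn amount s v

  shift : ∀ {n} → Colored T n → Colored T n
  shift = shiftBy inverse

  unshift : ∀ {n} → Colored T n → Colored T n
  unshift = shiftBy ((T ∸_) ∘ inverse)

  unshift-shift : ∀ {n} (v : Colored T n) → unshift (shift v) ≡ v
  unshift-shift = shiftBy-cancel inverse ((T ∸_) ∘ inverse) (λ c → ℕ.m∸n+n≡m (inverse≤p c))

  shift-unshift : ∀ {n} (v : Colored T n) → shift (unshift v) ≡ v
  shift-unshift = shiftBy-cancel ((T ∸_) ∘ inverse) inverse (λ c → ℕ.m+[n∸m]≡n (inverse≤p c))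

  isColored-shift : ∀ K {n} (v : Colored T n) → isColored K T n (shift v) ≡ isColored K T n v
  isColored-shift K {n} v = cong₂ _∧_ (≡true⇔⇒≡ (allValid-shiftBy K inverse v) reflected) (cong (ℕ._≡ᵇ n) (totalSize-shiftBy inverse v))
    where
    ≡true⇔⇒≡ : ∀ {a b : Bool} → (b ≡ true → a ≡ true) → (a ≡ true → b ≡ true) → a ≡ b
    ≡true⇔⇒≡ {true} {_} _ a⇒b = sym (a⇒b refl)
    ≡true⇔⇒≡ {false} {true} b⇒a _ = b⇒a refl
    ≡true⇔⇒≡ {false} {false} _ _ = refl
    reflected : allValid K (shift v) ≡ true → allValid K v ≡ true
    reflected valid = subst (λ u → allValid K u ≡ true) (unshift-shift v) (allValid-shiftBy K ((T ∸_) ∘ inverse) (shift v) valid)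

module ShiftResidue (h : ℕ) where
  open import Data.Nat as ℕ using (ℕ; suc; _/_)
  open import Data.Nat.DivMod using (m≡m%n+[m/n]*n)
  open import Data.Nat.Divisibility using (_∣_)
  open import Data.Nat.Primality using (Prime)
  open import Data.Integer using (+_; _+_; _-_; _*_)
  open import Data.Integer.Properties using (pos-+; pos-*)
  open import Data.Integer.Divisibility.Signed using (_∣?_)
  open import Data.Integer.Tactic.RingSolver using (solve-∀)
  open import Data.Maybe using (just; nothing)
  open import Data.Product using (proj₁; proj₂)
  open import Data.Empty using (⊥-elim)
  open import Relation.Binary.PropositionalEquality
  open import Relation.Nullary using (¬_)
  open import Relation.Nullary.Decidable using (does-⇔)
  open ≡-Reasoning
  open Columns using (partWeight)
  open ColumnSums using (columnSum; totalSize-divisible)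
  open RStar using (rstar-congruence)
  open Shift h
  open ModularInverse T using (inverse; inverse-correct)
  open Residues T using (∣-shift)

  rstarMod-rotateColumn : Prime T → ∀ i {n} s (v : Colored T n) → ¬ T ∣ columnSum v s →
    rstarMod i T (rotateColumn inverse s v) ≡ rstarMod (suc i) T v
  rstarMod-rotateColumn T-prime i s v T∤c =
    does-⇔ (∣-shift (Y₂ + + X - + q - Y₁) (rearrange (rstar w) (rstar v) (+ X) Y₁ Y₂ (+ q) (+ i) (+ T) combined))
      (+ T ∣? (rstar w - + i)) (+ T ∣? (rstar v - + suc i))
    where
    c = columnSum v s
    d = inverse c
    q = (d ℕ.* c) / T
    w = rotateColumn inverse s v
    X = proj₁ (partWeight-rotateColumn inverse s v)
    rotated = proj₂ (partWeight-rotateColumn inverse s v)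
    Y₁ = proj₁ (rstar-congruence h w)
    w-congruence = proj₂ (rstar-congruence h w)
    Y₂ = proj₁ (rstar-congruence h v)
    v-congruence = proj₂ (rstar-congruence h v)
    d*c≡1+qT : + 1 + + q * + T ≡ + (d ℕ.* c)
    d*c≡1+qT = sym (begin
      + (d ℕ.* c)          ≡⟨ cong +_ (trans (m≡m%n+[m/n]*n (d ℕ.* c) T) (cong (ℕ._+ q ℕ.* T) (inverse-correct T-prime c T∤c))) ⟩
      + (1 ℕ.+ q ℕ.* T)    ≡⟨ pos-+ 1 (q ℕ.* T) ⟩
      + 1 + + (q ℕ.* T)    ≡⟨ cong (λ x → + 1 + x) (pos-* q T) ⟩
      + 1 + + q * + T      ∎)
    combined : (rstar w + + T * Y₁) + (+ 1 + + q * + T) ≡ (rstar v + + T * Y₂) + + T * + X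
    combined = begin
      (rstar w + + T * Y₁) + (+ 1 + + q * + T) ≡⟨ cong₂ _+_ w-congruence d*c≡1+qT ⟩
      + partWeight 1 w + + (d ℕ.* c)           ≡⟨ sym (pos-+ (partWeight 1 w) (d ℕ.* c)) ⟩
      + (partWeight 1 w ℕ.+ d ℕ.* c)           ≡⟨ cong +_ rotated ⟩
      + (partWeight 1 v ℕ.+ T ℕ.* X)           ≡⟨ pos-+ (partWeight 1 v) (T ℕ.* X) ⟩
      + partWeight 1 v + + (T ℕ.* X)           ≡⟨ cong₂ _+_ (sym v-congruence) (pos-* T X) ⟩
      (rstar v + + T * Y₂) + + T * + X         ∎
    rearrange : ∀ A B X Y₁ Y₂ q i t → (A + t * Y₁) + (+ 1 + q * t) ≡ (B + t * Y₂) + t * X →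
      A - i ≡ (B - (+ 1 + i)) + t * (Y₂ + X - q - Y₁)
    rearrange A B X Y₁ Y₂ q i t eq = begin
      A - i                                            ≡⟨ expand A Y₁ q i t ⟩
      ((A + t * Y₁) + (+ 1 + q * t)) - t * Y₁ - + 1 - q * t - i ≡⟨ cong (λ x → x - t * Y₁ - + 1 - q * t - i) eq ⟩
      ((B + t * Y₂) + t * X) - t * Y₁ - + 1 - q * t - i ≡⟨ collect B X Y₁ Y₂ q i t ⟩
      (B - (+ 1 + i)) + t * (Y₂ + X - q - Y₁)         ∎
      where
      expand : ∀ A Y₁ q i t → A - i ≡ ((A + t * Y₁) + (+ 1 + q * t)) - t * Y₁ - + 1 - q * t - i
      expand = solve-∀
      collect : ∀ B X Y₁ Y₂ q i t → ((B + t * Y₂) + t * X) - t * Y₁ - + 1 - q * t - i ≡ (B - (+ 1 + i)) + t * (Y₂ + X - q - Y₁)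
      collect = solve-∀

  rstarMod-shift : Prime T → ∀ i {n} (v : Colored T n) → ¬ T ∣ totalSize v → rstarMod i T (shift v) ≡ rstarMod (suc i) T v
  rstarMod-shift T-prime i v T∤n with firstNonDivisible (columnSum v) in eq
  ... | nothing = ⊥-elim (T∤n (totalSize-divisible T v (firstNonDivisible-nothing (columnSum v) eq)))
  ... | just s = rstarMod-rotateColumn T-prime i s v (firstNonDivisible-just (columnSum v) eq)

module Equidistribution (h : ℕ) where
  open import Data.Nat as ℕ using (ℕ; zero; suc; _*_; _∸_)
  import Data.Nat.Properties as ℕ
  open import Data.Nat.Divisibility using (_∣_)
  open import Data.Nat.Primality using (Prime)
  open import Data.Bool as Bool using (true; false; _∧_)
  open import Data.Bool.Properties using (∧-conicalʳ)
  open import Data.List using (filterᵇ; length)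
  open import Relation.Binary.PropositionalEquality
  open import Relation.Nullary using (¬_)
  open import Function using (_∘_)
  open import Data.List.Membership.Propositional using (_∈_)
  open ≡-Reasoning
  open Counting
  open Enumeration using (candidates-unique; ∈-candidates⁺; ∈-candidates⁻)
  open Classes
  open Shift h
  open ShiftResidue h using (rstarMod-shift)
  open Residues T using (residue-unique)
  open ModularInverse T using (inverse)

  inClass-shift : Prime T → ∀ {n} → ¬ T ∣ n → ∀ K i (v : Colored T n) → inClass K i T (shift v) ≡ inClass K (suc i) T v
  inClass-shift T-prime {n} T∤n K i v with isColored K T n v in colored
  ... | false = cong (_∧ rstarMod i T (shift v)) (trans (isColored-shift K v) colored)
  ... | true = cong₂ _∧_ (trans (isColored-shift K v) colored) (rstarMod-shift T-prime i v (λ T∣size → T∤n (subst (T ∣_) size≡n T∣size)))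
    where
    size≡n : totalSize v ≡ n
    size≡n = ℕ.≡ᵇ⇒≡ (totalSize v) n (subst Bool.T (sym (∧-conicalʳ _ _ colored)) _)

  countM-suc : Prime T → ∀ {n} → ¬ T ∣ n → ∀ K i → countM K (suc i) T n ≡ countM K i T n
  countM-suc T-prime {n} T∤n K i = begin
    length (filterᵇ (inClass K (suc i) T) (candidates T n))
      ≡⟨ cong length (filterᵇ-cong (λ v → sym (inClass-shift T-prime T∤n K i v)) (candidates T n)) ⟩
    length (filterᵇ (inClass K i T ∘ shift) (candidates T n))
      ≡⟨ length-filterᵇ-bijection (inClass K i T) (candidates-unique T n)
           unshift-shift shift-unshift (closed {inverse}) (closed {(T ∸_) ∘ inverse}) ⟩
    length (filterᵇ (inClass K i T) (candidates T n)) ∎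
    where
    closed : ∀ {amount} {v : Colored T n} → v ∈ candidates T n → shiftBy amount v ∈ candidates T n
    closed {amount} {v} v∈ = ∈-candidates⁺ (shiftBy amount v) (All-shiftBy amount v (∈-candidates⁻ v v∈))

  countM-zero : Prime T → ∀ {n} → ¬ T ∣ n → ∀ K i → countM K i T n ≡ countM K 0 T n
  countM-zero T-prime T∤n K zero = refl
  countM-zero T-prime T∤n K (suc i) = trans (countM-suc T-prime T∤n K i) (countM-zero T-prime T∤n K i)

  T*countM : Prime T → ∀ {n} → ¬ T ∣ n → ∀ K i → T * countM K i T n ≡ count K T n
  T*countM T-prime {n} T∤n K i = begin
    T * countM K i T n                   ≡⟨ cong (T *_) (countM-zero T-prime T∤n K i) ⟩
    T * countM K 0 T n                   ≡⟨ sym (sumBelow-const (countM K 0 T n) T) ⟩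
    sumBelow (λ _ → countM K 0 T n) T    ≡⟨ sumBelow-cong T (λ j _ → sym (countM-zero T-prime T∤n K j)) ⟩
    sumBelow (λ j → countM K j T n) T    ≡⟨ length-filterᵇ-classes (isColored K T n) (λ j → rstarMod j T) T (residue-unique ∘ rstar) (candidates T n) ⟩
    count K T n                          ∎

module OverpartitionParity where
  open import Data.Nat using (suc; _+_; _*_; _≡ᵇ_)
  open import Data.Nat.Properties using (+-identityʳ; *-comm)
  open import Data.Nat.Divisibility using (_∣_; divides)
  open import Data.Bool using (false; _∧_; not)
  open import Data.Bool.Properties using (∧-zeroʳ)
  open import Data.Maybe using (just; nothing)
  open import Data.List using (filterᵇ; length)
  open import Data.List.Membership.Propositional using (_∈_)
  open import Relation.Binary.PropositionalEquality
  open ≡-Reasoning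
  open Counting using (filterᵇ-cong; length-filterᵇ-bijection; length-filterᵇ-split)
  open Enumeration using (candidates-unique; ∈-candidates⁺; ∈-candidates⁻)
  open RStar using (rstarMod-numParts)
  open Overline
  open Classes

  inClass-flip : ∀ i t m (v : Colored t (suc m)) →
    inClass overpartitionCell i t (flip v) ∧ firstOverlined (flip v) ≡ inClass overpartitionCell i t v ∧ not (firstOverlined v)
  inClass-flip i t m v with flipFirst v in eq
  ... | just w = cong₂ _∧_ same-class (flipFirst-overlined v w eq)
    where
    same-class : inClass overpartitionCell i t w ≡ inClass overpartitionCell i t v
    same-class = cong₂ _∧_
      (cong₂ _∧_ (flipFirst-valid v w eq) (cong (_≡ᵇ suc m) (flipFirst-totalSize v w eq)))
      (rstarMod-numParts i v w (flipFirst-numParts v w eq))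
  ... | nothing = trans (cong (_∧ firstOverlined v) empty-unclassified) (sym (cong (_∧ not (firstOverlined v)) empty-unclassified))
    where
    empty-unclassified : inClass overpartitionCell i t v ≡ false
    empty-unclassified = trans (cong (λ s → (allValid overpartitionCell v ∧ (s ≡ᵇ suc m)) ∧ rstarMod i t v) (flipFirst-empty v eq))
                               (cong (_∧ rstarMod i t v) (∧-zeroʳ (allValid overpartitionCell v)))

  countM-even : ∀ i t m → 2 ∣ countM overpartitionCell i t (suc m)
  countM-even i t m = divides A (begin
    countM overpartitionCell i t (suc m)                        ≡⟨ length-filterᵇ-split P firstOverlined xs ⟩
    A + length (filterᵇ (λ v → P v ∧ not (firstOverlined v)) xs) ≡⟨ cong (λ x → A + x) (sym paired) ⟩
    A + A                                                       ≡⟨ cong (λ x → A + x) (sym (+-identityʳ A)) ⟩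
    2 * A                                                       ≡⟨ *-comm 2 A ⟩
    A * 2                                                       ∎)
    where
    xs = candidates t (suc m)
    P = inClass overpartitionCell i t
    A = length (filterᵇ (λ v → P v ∧ firstOverlined v) xs)
    closed : ∀ {v} → v ∈ xs → flip v ∈ xs
    closed {v} v∈ with flipFirst v in eq
    ... | nothing = v∈
    ... | just w = ∈-candidates⁺ w (flipFirst-cells v w eq (∈-candidates⁻ v v∈))
    paired : A ≡ length (filterᵇ (λ v → P v ∧ not (firstOverlined v)) xs)
    paired = trans
      (sym (length-filterᵇ-bijection (λ v → P v ∧ firstOverlined v) (candidates-unique t (suc m))
              flip-involutive flip-involutive closed closed))
      (cong length (filterᵇ-cong (inClass-flip i t m) xs))


open import Data.Nat using (zero; suc; _*_; _%_; _<_)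
open import Data.Nat.Properties using (*-comm)
open import Data.Nat.Divisibility using (_∣_; divides; _∣0)
open import Data.Nat.Primality using (Prime)
open import Data.Nat.Tactic.RingSolver using (solve-∀)
open import Data.Product using (_×_; _,_)
open import Data.Empty using (⊥-elim)
open import Relation.Binary.PropositionalEquality using (_≡_; refl; sym; trans; cong)
open import Relation.Nullary using (¬_)

theorem2p5 : (t n : ℕ) → Prime t → t % 2 ≡ 1 → ¬ (t ∣ n) →
    ((i : ℕ) → i < t →
      (t * M i t n ≡ p t n)
      × (t * Mbar i t n ≡ pbar t n) × (2 ∣ Mbar i t n)
      × (t * Mhat i t n ≡ phat t n))
    × (t ∣ p t n) × (t ∣ phat t n) × ((2 * t) ∣ pbar t n)
theorem2p5 t zero _ _ t∤0 = ⊥-elim (t∤0 (t ∣0))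
theorem2p5 t (suc m) t-prime t-odd t∤n with RStar.odd⇒suc-double t t-odd
... | h , refl =
  (λ i _ → equidistributed partitionCell i , equidistributed overpartitionCell i , OverpartitionParity.countM-even i t m
         , equidistributed podCell i) ,
  divides-count partitionCell , divides-count podCell , divides-pbar
  where
  open Equidistribution h
  equidistributed : ∀ K i → t * countM K i t (suc m) ≡ count K t (suc m)
  equidistributed = T*countM t-prime t∤n
  divides-count : ∀ K → t ∣ count K t (suc m)
  divides-count K = divides (countM K 0 t (suc m)) (trans (sym (equidistributed K 0)) (*-comm t _))
  divides-pbar : 2 * t ∣ pbar t (suc m)
  divides-pbar with OverpartitionParity.countM-even 0 t m
  ... | divides A even = divides A (trans (sym (equidistributed overpartitionCell 0)) (trans (cong (t *_) even) (regroup t A)))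
    where
    regroup : ∀ t a → t * (a * 2) ≡ a * (2 * t)
    regroup = solve-∀
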